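{- Let $w$ be a double occurrence word in ascending order of length $n$, $\nu\ge1$, and let $\mathcal I_1(\nu,k_1,\ell_1)$, $\mathcal I_2(\nu,k_2,\ell_2)$ be insertions into $w$ with $w\star\mathcal I_1(\nu,k_1,\ell_1)\sim w\star\mathcal I_2(\nu,k_2,\ell_2)$, $k_1=1$, $\ell_2=n+1$ and $k_1\le\ell_1<k_2\le\ell_2$. Write $w=z_1z_2z_3$ with $|z_1|=\ell_1-1$ and $|z_1z_2|=k_2-1$. Then $k_2-\ell_1=2p\nu$ for some positive integer $p$, and $|z_1|=|z_3|=q$ for some $q\ge0$. Moreover, if $\mathcal I_1,\mathcal I_2$ are both repeat insertions then $z_1z_2z_3\sim T_\rho(\nu,q,p)$, while if $\mathcal I_1,\mathcal I_2$ are both return insertions then $\nu$ divides $q$ and $z_1z_2z_3\sim T_\tau(\nu,q,p)$.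
   Context: Alphabet $\Sigma=\mathbb{N}$; words are finite sequences over $\Sigma$, $|w|$ is length, $w^R$ the reverse. A double occurrence word (DOW) is a word in which every symbol occurs zero or exactly two times. An equivalence map is a morphism of $\Sigma^*$ induced by a bijection $\Sigma\to\Sigma$; $x\sim y$ means $f(x)=y$ for some equivalence map $f$. A word is in ascending order if it is empty or its first symbol is $1$ and the first occurrence of each symbol is one greater than the largest symbol preceding it. Insertions: for a DOW $w$ in ascending order with largest symbol $M$ ($M=0$ if $w$ is empty), $\nu\ge1$, $u=(M+1)\cdots(M+\nu)$ and $1\le k\le\ell\le|w|+1$, write $w=y_1y_2y_3$ with $|y_1|=k-1$, $|y_1y_2|=\ell-1$; the repeat insertion gives $w\star\rho(\nu,k,\ell)=y_1uy_2uy_3$ and the return insertion gives $w\star\tau(\nu,k,\ell)=y_1uy_2u^Ry_3$; $\mathcal I(\nu,k,\ell)$ denotes either. For $h,\nu\ge1$ let $x_i=((i-1)\nu+1)\cdots(i\nu)$; $\mathrm{Int}(h,\nu)=x_1\cdots x_hx_1^R\cdots x_h^R$. Tangled cords: for $m\ge0$, $\nu,j\ge1$, let $s_0=12\cdots m12\cdots m$ ($\epsilon$ if $m=0$), $s_j=s_{j-1}\star\rho(\nu,|s_{j-1}|-m+1,|s_{j-1}|+1)$, $T_\rho(\nu,m,j)=s_j$. If $\nu\mid m$, let $t_0=\mathrm{Int}(m/\nu,\nu)$ ($\epsilon$ if $m=0$), $t_j=t_{j-1}\star\tau(\nu,|t_{j-1}|-m+1,|t_{j-1}|+1)$, $T_\tau(\nu,m,j)=t_j$.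 -}

module Defs where

open import Data.Nat using (ℕ; zero; suc; _+_; _*_; _∸_; _⊔_; _≤_; _<_)
open import Data.Nat.DivMod using (_/_)
open import Data.List using (List; []; _∷_; _++_; length; take; drop; reverse; map; foldr; applyUpTo; concat; lookup; filter)
open import Data.List.Membership.Propositional using (_∉_)
open import Data.Fin using (Fin; toℕ)
open import Data.Product using (Σ; ∃; _×_)
open import Data.Sum using (_⊎_)
open import Function.Bundles using (_⤖_; Bijection)
open import Relation.Binary.PropositionalEquality using (_≡_)
open import Data.Nat.Properties using (_≟_)

Word : Set
Word = List ℕ

occ : ℕ → Word → ℕ
occ a w = length (filter (a ≟_) w)

DOW : Word → Set
DOW w = ∀ (a : ℕ) → occ a w ≡ 0 ⊎ occ a w ≡ 2

maxSym : Word → ℕ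
maxSym = foldr _⊔_ 0

-- ascending order: at each position, if the symbol does not occur earlier,
-- it equals one more than the largest symbol preceding it
-- (for position 0 this forces the first symbol to be 1)
Ascending : Word → Set
Ascending w = ∀ (i : Fin (length w)) →
  lookup w i ∉ take (toℕ i) w → lookup w i ≡ suc (maxSym (take (toℕ i) w))

_∼_ : Word → Word → Set
x ∼ y = Σ (ℕ ⤖ ℕ) (λ f → map (Bijection.to f) x ≡ y)

block : ℕ → ℕ → Word
block M ν = applyUpTo (λ i → suc (M + i)) ν

data Kind : Set where
  rep : Kind
  ret : Kind

insert : Kind → Word → ℕ → ℕ → ℕ → Word
insert K w ν k ℓ =
  let u  = block (maxSym w) ν
      y₁ = take (k ∸ 1) w
      y₂ = take (ℓ ∸ k) (drop (k ∸ 1) w)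
      y₃ = drop (ℓ ∸ 1) w
      u′ = second K u
  in y₁ ++ u ++ y₂ ++ u′ ++ y₃
  where
  second : Kind → Word → Word
  second rep u = u
  second ret u = reverse u

Int : ℕ → ℕ → Word
Int h ν = concat (applyUpTo (λ i → block (i * ν) ν) h)
       ++ concat (applyUpTo (λ i → reverse (block (i * ν) ν)) h)

s₀ : ℕ → Word
s₀ m = applyUpTo suc m ++ applyUpTo suc m

iterT : Kind → ℕ → ℕ → ℕ → Word → Word
iterT K ν m zero    s = s
iterT K ν m (suc j) s =
  let s′ = iterT K ν m j s
  in insert K s′ ν (length s′ ∸ m + 1) (length s′ + 1)

Tρ : ℕ → ℕ → ℕ → Word
Tρ ν m j = iterT rep ν m j (s₀ m)

-- T_τ(ν,m,j), meaningful when ν ≥ 1 and ν ∣ m; t₀ = Int(m/ν, ν)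
Tτ : ℕ → ℕ → ℕ → Word
Tτ zero       m j = []   -- junk value; never used (ν ≥ 1)
Tτ (suc ν′)   m j = iterT ret (suc ν′) m j (Int (m / suc ν′) (suc ν′))

{-# OPTIONS --safe #-}
-- Equivalent words are exactly the words with the same equality pattern on positions
-- (SamePattern), so the proof compares positions. Let w = z₁z₂z₃ with |z₁| = a, |z₂| = d,
-- |z₃| = c, and compare A = u z₁ u′ z₂ z₃ with B = z₁ z₂ u z₃ u′ (u′ = u or uᴿ). A symbol of
-- B's first inserted block occurs exactly once more, in B's second block; hence the letter
-- of A at the same position pairs up in the same way. For d ≥ 2ν this says that the ν
-- letters of w starting at a + d − 2ν, together with the last ν letters of w, form an
-- insertion of the second kind into a shorter word w₀, for which the hypothesis holds with
-- gap d − 2ν. For d = 0 and a, c ≥ ν the same argument removes the last ν letters of z₁ and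
-- of z₃. A gap 0 < d < 2ν, or d = 0 with c < ν ≤ a, would give an inserted symbol of B a
-- partner outside its two blocks. What remains is d = 0 and a < ν, where c = a and w has the
-- pattern 1⋯a1⋯a (two repeat insertions) or is empty (two return insertions). Undoing the
-- reductions rebuilds w exactly as the iterations defining T_ρ(ν,q,p) and T_τ(ν,q,p), p
-- being the number of gap reductions.
module Submission where

open import Defs
open import Data.Nat using (ℕ; zero; suc; _+_; _*_; _∸_; _⊔_; _≤_; _<_; s≤s; z≤n; _<?_)
open import Data.Nat.Properties
open import Data.List using ([]; _++_; _∷_; applyUpTo; concat; drop; length; map; reverse; take)
open import Data.List.Properties
  using (take-all; drop-all; length-map; ++-assoc; ++-identityʳ; applyUpTo-∷ʳ; concat-++; drop-drop
        ; length-++; length-applyUpTo; length-drop; length-reverse; length-take; map-∘; take++drop≡id; unfold-reverse)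
open import Data.Product using (_,_; _×_; proj₁; proj₂; Σ; ∃)
open import Data.Sum using (_⊎_; inj₁; inj₂)
open import Data.Sum.Properties using (inj₁-injective; inj₂-injective)
open import Data.Empty using (⊥; ⊥-elim)
open import Relation.Binary.PropositionalEquality
open import Relation.Nullary using (no; yes)
open import Function.Base using (_∘_)
open import Function.Bundles using (Bijection; _⤖_; mk⤖)
open import Function.Construct.Composition using (_⤖-∘_)
open import Function.Construct.Identity using (⤖-id)
open import Data.Unit using (tt; ⊤)
open import Data.Nat.Tactic.RingSolver
open import Data.Nat.Divisibility using (_∣_; divides)
open import Data.Nat.DivMod using (m*n/n≡m)
open import Data.Nat.Induction using (<-rec)

at : Word → ℕ → ℕ
at [] _ = 0
at (x ∷ xs) zero = x
at (x ∷ xs) (suc i) = at xs i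

at-++ˡ : ∀ xs ys i → i < length xs → at (xs ++ ys) i ≡ at xs i
at-++ˡ (x ∷ xs) ys zero _ = refl
at-++ˡ (x ∷ xs) ys (suc i) (s≤s p) = at-++ˡ xs ys i p

at-++ʳ : ∀ xs ys i → at (xs ++ ys) (length xs + i) ≡ at ys i
at-++ʳ [] ys i = refl
at-++ʳ (x ∷ xs) ys i = at-++ʳ xs ys i

at-take : ∀ k xs i → i < k → at (take k xs) i ≡ at xs i
at-take (suc k) [] i _ = refl
at-take (suc k) (x ∷ xs) zero _ = refl
at-take (suc k) (x ∷ xs) (suc i) (s≤s p) = at-take k xs i p

at-drop : ∀ k xs i → at (drop k xs) i ≡ at xs (k + i)
at-drop zero xs i = refl
at-drop (suc k) [] i = refl
at-drop (suc k) (x ∷ xs) i = at-drop k xs i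

at-map : ∀ (f : ℕ → ℕ) xs i → i < length xs → at (map f xs) i ≡ f (at xs i)
at-map f (x ∷ xs) zero _ = refl
at-map f (x ∷ xs) (suc i) (s≤s p) = at-map f xs i p

at-applyUpTo : ∀ (f : ℕ → ℕ) n i → i < n → at (applyUpTo f n) i ≡ f i
at-applyUpTo f (suc n) zero _ = refl
at-applyUpTo f (suc n) (suc i) (s≤s p) = at-applyUpTo (λ k → f (suc k)) n i p

at-reverse : ∀ xs i → i < length xs → at (reverse xs) i ≡ at xs (length xs ∸ suc i)
at-reverse (x ∷ xs) i p rewrite unfold-reverse x xs with m≤n⇒m<n∨m≡n (≤-pred p)
... | inj₁ q = begin
      at (reverse xs ++ x ∷ []) i ≡⟨ at-++ˡ (reverse xs) (x ∷ []) i (subst (i <_) (sym (length-reverse xs)) q) ⟩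
      at (reverse xs) i ≡⟨ at-reverse xs i q ⟩
      at xs (length xs ∸ suc i) ≡⟨ cong (at (x ∷ xs)) (+-∸-assoc 1 q) ⟨
      at (x ∷ xs) (length xs ∸ i) ∎
  where open ≡-Reasoning
... | inj₂ refl = begin
      at (reverse xs ++ x ∷ []) (length xs) ≡⟨ cong (at (reverse xs ++ x ∷ [])) (sym (trans (cong (_+ 0) (length-reverse xs)) (+-identityʳ _))) ⟩
      at (reverse xs ++ x ∷ []) (length (reverse xs) + 0) ≡⟨ at-++ʳ (reverse xs) (x ∷ []) 0 ⟩
      x ≡⟨ cong (at (x ∷ xs)) (sym (n∸n≡0 (length xs))) ⟩
      at (x ∷ xs) (length xs ∸ length xs) ∎
  where open ≡-Reasoning

at≤maxSym : ∀ w i → i < length w → at w i ≤ maxSym w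
at≤maxSym (x ∷ w) zero _ = m≤m⊔n x (maxSym w)
at≤maxSym (x ∷ w) (suc i) (s≤s p) = ≤-trans (at≤maxSym w i p) (m≤n⊔m x (maxSym w))

record SamePattern (x y : Word) : Set where
  field
    length≡ : length x ≡ length y
    preserves : ∀ i j → i < length x → j < length x → at x i ≡ at x j → at y i ≡ at y j
    reflects : ∀ i j → i < length x → j < length x → at y i ≡ at y j → at x i ≡ at x j
open SamePattern public

SamePattern-refl : ∀ {x} → SamePattern x x
SamePattern-refl = record { length≡ = refl ; preserves = λ _ _ _ _ e → e ; reflects = λ _ _ _ _ e → e }

SamePattern-sym : ∀ {x y} → SamePattern x y → SamePattern y x
SamePattern-sym {x} {y} p = record { length≡ = sym (length≡ p)
  ; preserves = λ i j a b e → reflects p i j (subst (i <_) (sym (length≡ p)) a) (subst (j <_) (sym (length≡ p)) b) e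
  ; reflects = λ i j a b e → preserves p i j (subst (i <_) (sym (length≡ p)) a) (subst (j <_) (sym (length≡ p)) b) e }

SamePattern-trans : ∀ {x y z} → SamePattern x y → SamePattern y z → SamePattern x z
SamePattern-trans p q = record { length≡ = trans (length≡ p) (length≡ q)
  ; preserves = λ i j a b e → preserves q i j (subst (i <_) (length≡ p) a) (subst (j <_) (length≡ p) b) (preserves p i j a b e)
  ; reflects = λ i j a b e → reflects p i j a b (reflects q i j (subst (i <_) (length≡ p) a) (subst (j <_) (length≡ p) b) e) }

∼⇒SamePattern : ∀ {x y} → x ∼ y → SamePattern x y
∼⇒SamePattern {x} {y} (f , refl) = record
  { length≡ = sym (length-map F x)
  ; preserves = λ i j a b e → trans (at-map F x i a) (trans (cong F e) (sym (at-map F x j b)))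
  ; reflects = λ i j a b e → Bijection.injective f (trans (sym (at-map F x i a)) (trans e (at-map F x j b))) }
  where
  F : ℕ → ℕ
  F = Bijection.to f

swap : ℕ → ℕ → ℕ → ℕ
swap p q x with x ≟ p
... | yes _ = q
... | no _ with x ≟ q
...   | yes _ = p
...   | no _ = x

swap-second : ∀ p q → swap p q q ≡ p
swap-second p q with q ≟ p
... | yes e = e
... | no _ with q ≟ q
...   | yes _ = refl
...   | no ne = ⊥-elim (ne refl)

swap-first : ∀ p q → swap p q p ≡ q
swap-first p q with p ≟ p
... | yes _ = refl
... | no ne = ⊥-elim (ne refl)

swap-other : ∀ p q x → x ≢ p → x ≢ q → swap p q x ≡ x
swap-other p q x np nq with x ≟ p
... | yes e = ⊥-elim (np e)
... | no _ with x ≟ q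
...   | yes e = ⊥-elim (nq e)
...   | no _ = refl

swap-involutive : ∀ p q x → swap p q (swap p q x) ≡ x
swap-involutive p q x with x ≟ p
... | yes e = trans (swap-second p q) (sym e)
... | no np with x ≟ q
...   | yes e = trans (swap-first p q) (sym e)
...   | no nq = swap-other p q x np nq

swap⤖ : ℕ → ℕ → (ℕ ⤖ ℕ)
swap⤖ p q = mk⤖ {to = swap p q} (inj , surj)
  where
  inj : ∀ {x y} → swap p q x ≡ swap p q y → x ≡ y
  inj {x} {y} e = trans (sym (swap-involutive p q x)) (trans (cong (swap p q) e) (swap-involutive p q y))
  surj : ∀ y → ∃ λ x → ∀ {z} → z ≡ x → swap p q z ≡ y
  surj y = swap p q y , λ { refl → swap-involutive p q y }

map-fixing≡id : ∀ (h : ℕ → ℕ) ys → (∀ k → k < length ys → h (at ys k) ≡ at ys k) → map h ys ≡ ys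
map-fixing≡id h [] _ = refl
map-fixing≡id h (y ∷ ys) H = cong₂ _∷_ (H 0 (s≤s z≤n)) (map-fixing≡id h ys (λ k p → H (suc k) (s≤s p)))

search : ∀ a x → (Σ ℕ λ k → k < length x × at x k ≡ a) ⊎ (∀ k → k < length x → at x k ≢ a)
search a [] = inj₂ (λ k ())
search a (y ∷ x) with y ≟ a
... | yes e = inj₁ (0 , s≤s z≤n , e)
... | no ne with search a x
...   | inj₁ (k , p , e) = inj₁ (suc k , s≤s p , e)
...   | inj₂ f = inj₂ λ { zero _ → ne ; (suc k) (s≤s p) → f k p }

SamePattern-tail : ∀ {a b x y} → SamePattern (a ∷ x) (b ∷ y) → SamePattern x y
SamePattern-tail p = record
  { length≡ = suc-injective (length≡ p)
  ; preserves = λ i j u v e → preserves p (suc i) (suc j) (s≤s u) (s≤s v) e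
  ; reflects = λ i j u v e → reflects p (suc i) (suc j) (s≤s u) (s≤s v) e }

module _ {a b : ℕ} {x y : Word} (p : SamePattern (a ∷ x) (b ∷ y)) (g : ℕ ⤖ ℕ) (g[x]≡y : map (Bijection.to g) x ≡ y) where
  private
    G : ℕ → ℕ
    G = Bijection.to g

  renames-repeated-head : ∀ k → k < length x → at x k ≡ a → G a ≡ b
  renames-repeated-head k k< x[k]≡a = sym (begin
    b              ≡⟨ preserves p 0 (suc k) (s≤s z≤n) (s≤s k<) (sym x[k]≡a) ⟩
    at y k         ≡⟨ cong (λ z → at z k) g[x]≡y ⟨
    at (map G x) k ≡⟨ at-map G x k k< ⟩
    G (at x k)     ≡⟨ cong G x[k]≡a ⟩
    G a            ∎)
    where open ≡-Reasoning

  swap-renames-fresh-head : (∀ k → k < length x → at x k ≢ a) → map (swap b (G a) ∘ G) x ≡ y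
  swap-renames-fresh-head fresh = begin
    map (swap b (G a) ∘ G) x     ≡⟨ map-∘ x ⟩
    map (swap b (G a)) (map G x) ≡⟨ cong (map (swap b (G a))) g[x]≡y ⟩
    map (swap b (G a)) y         ≡⟨ map-fixing≡id (swap b (G a)) y fixed ⟩
    y                            ∎
    where
    open ≡-Reasoning
    fixed : ∀ k → k < length y → swap b (G a) (at y k) ≡ at y k
    fixed k k<y = swap-other b (G a) (at y k) ≢b ≢Ga
      where
      k<x : k < length x
      k<x = subst (k <_) (sym (suc-injective (length≡ p))) k<y
      ≢b : at y k ≢ b
      ≢b e = fresh k k<x (sym (reflects p 0 (suc k) (s≤s z≤n) (s≤s k<x) (sym e)))
      ≢Ga : at y k ≢ G a
      ≢Ga e = fresh k k<x (Bijection.injective g (trans (sym (at-map G x k k<x)) (trans (cong (λ z → at z k) g[x]≡y) e)))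

SamePattern⇒∼ : ∀ x y → SamePattern x y → x ∼ y
SamePattern⇒∼ [] [] p = ⤖-id ℕ , refl
SamePattern⇒∼ [] (_ ∷ _) p with () ← length≡ p
SamePattern⇒∼ (_ ∷ _) [] p with () ← length≡ p
SamePattern⇒∼ (a ∷ x) (b ∷ y) p with SamePattern⇒∼ x y (SamePattern-tail p) | search a x
... | g , g[x]≡y | inj₁ (k , k< , x[k]≡a) = g , cong₂ _∷_ (renames-repeated-head p g g[x]≡y k k< x[k]≡a) g[x]≡y
... | g , g[x]≡y | inj₂ fresh =
  swap⤖ b (Bijection.to g a) ⤖-∘ g , cong₂ _∷_ (swap-second b (Bijection.to g a)) (swap-renames-fresh-head p g g[x]≡y fresh)

≤-witness : ∀ x y k → x + k ≡ y → x ≤ y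
≤-witness x y k eq = subst (x ≤_) eq (m≤m+n x k)

<-witness : ∀ x y k → x + suc k ≡ y → x < y
<-witness x y k eq = subst (x <_) eq (subst (x <_) (sym (+-suc x k)) (s≤s (m≤m+n x k)))

+-cancelˡ-at : ∀ P {x y} x' y' → x ≡ P + x' → y ≡ P + y' → x ≡ y → x' ≡ y'
+-cancelˡ-at P x' y' ex ey eq = +-cancelˡ-≡ P x' y' (trans (sym ex) (trans eq ey))

_⇔_ : Set → Set → Set
A ⇔ B = (A → B) × (B → A)

second : Kind → Word → Word
second rep u = u
second ret u = reverse u

-- insert K w ν (s + 1) (s + e + 1), with the offsets made explicit to avoid truncated subtraction.
insertAt : Kind → Word → ℕ → ℕ → ℕ → Word
insertAt K w ν s e = take s w ++ block (maxSym w) ν ++ take e (drop s w) ++ second K (block (maxSym w) ν) ++ drop (s + e) w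

insert≡insertAt : ∀ K w ν s e → insert K w ν (suc s) (suc (s + e)) ≡ insertAt K w ν s e
insert≡insertAt rep w ν s e rewrite m+n∸m≡n s e = refl
insert≡insertAt ret w ν s e rewrite m+n∸m≡n s e = refl

partner : Kind → ℕ → ℕ → ℕ
partner rep ν i = i
partner ret ν i = ν ∸ suc i

partner< : ∀ K ν i → i < ν → partner K ν i < ν
partner< rep ν i p = p
partner< ret ν i p = ∸-monoʳ-< {o = 0} (s≤s z≤n) p

partner-involutive : ∀ K ν i → i < ν → partner K ν (partner K ν i) ≡ i
partner-involutive rep ν i p = refl
partner-involutive ret ν i p with m+[n∸m]≡n p
... | eq = subst (λ v → v ∸ suc (v ∸ suc i) ≡ i) eq (lem i (ν ∸ suc i))
  where
  lem : ∀ i k → suc i + k ∸ suc (suc i + k ∸ suc i) ≡ i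
  lem i k rewrite m+n∸m≡n i k = m+n∸n≡m i k

partner-injective : ∀ K ν i i' → i < ν → i' < ν → partner K ν i ≡ partner K ν i' → i ≡ i'
partner-injective K ν i i' p p' e = trans (sym (partner-involutive K ν i p)) (trans (cong (partner K ν) e) (partner-involutive K ν i' p'))

length-block : ∀ M ν → length (block M ν) ≡ ν
length-block M ν = length-applyUpTo _ ν

at-block : ∀ M ν i → i < ν → at (block M ν) i ≡ suc (M + i)
at-block M ν i p = at-applyUpTo _ ν i p

length-second : ∀ K u → length (second K u) ≡ length u
length-second rep u = refl
length-second ret u = length-reverse u

at-second : ∀ K M ν i → i < ν → at (second K (block M ν)) i ≡ suc (M + partner K ν i)
at-second rep M ν i p = at-block M ν i p
at-second ret M ν i p = trans (at-reverse (block M ν) i (subst (i <_) (sym (length-block M ν)) p))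
                        (trans (cong (λ v → at (block M ν) (v ∸ suc i)) (length-block M ν)) (at-block M ν _ (partner< ret ν i p)))

data Slot (s e f ν x : ℕ) : Set where
  pre : ∀ j → j < s → x ≡ j → Slot s e f ν x
  blk₁ : ∀ i → i < ν → x ≡ s + i → Slot s e f ν x
  mid : ∀ j → j < e → x ≡ s + (ν + j) → Slot s e f ν x
  blk₂ : ∀ i → i < ν → x ≡ s + (ν + (e + i)) → Slot s e f ν x
  suf : ∀ j → j < f → x ≡ s + (ν + (e + (ν + j))) → Slot s e f ν x

slotCount : ℕ → ℕ → ℕ → ℕ → ℕ
slotCount s e f ν = s + (ν + (e + (ν + f)))

<⊎+ : ∀ m x → (x < m) ⊎ (Σ ℕ λ y → x ≡ m + y)
<⊎+ m x with x <? m
... | yes p = inj₁ p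
... | no p = inj₂ (x ∸ m , sym (m+[n∸m]≡n (≮⇒≥ p)))

slot : ∀ s e f ν x → x < slotCount s e f ν → Slot s e f ν x
slot s e f ν x p with <⊎+ s x
... | inj₁ q = pre x q refl
... | inj₂ (y , refl) with <⊎+ ν y
...   | inj₁ q = blk₁ y q refl
...   | inj₂ (y' , refl) with <⊎+ e y'
...     | inj₁ q = mid y' q refl
...     | inj₂ (y'' , refl) with <⊎+ ν y''
...       | inj₁ q = blk₂ y'' q refl
...       | inj₂ (j , refl) = suf j (+-cancelˡ-< ν _ _ (+-cancelˡ-< e _ _ (+-cancelˡ-< ν _ _ (+-cancelˡ-< s _ _ p)))) refl

data Origin : Set where
  fromWord : ℕ → Origin
  fromBlock : ℕ → Origin

origin : Kind → ∀ {s e f ν x} → Slot s e f ν x → Origin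
origin K (pre j _ _) = fromWord j
origin K (blk₁ i _ _) = fromBlock i
origin K {s} (mid j _ _) = fromWord (s + j)
origin K {ν = ν} (blk₂ i _ _) = fromBlock (partner K ν i)
origin K {s} {e} (suf j _ _) = fromWord (s + e + j)

interpret : Word → Origin → ℕ ⊎ ℕ
interpret w (fromWord j) = inj₁ (at w j)
interpret w (fromBlock i) = inj₂ i

meaning : Kind → Word → ∀ {s e f ν x} → Slot s e f ν x → ℕ ⊎ ℕ
meaning K w c = interpret w (origin K c)

encode : ℕ → ℕ ⊎ ℕ → ℕ
encode M (inj₁ v) = v
encode M (inj₂ i) = suc (M + i)

Encodable : ℕ → ℕ ⊎ ℕ → Set
Encodable M (inj₁ v) = v ≤ M
Encodable M (inj₂ _) = ⊤

encode-injective : ∀ M m m' → Encodable M m → Encodable M m' → encode M m ≡ encode M m' → m ≡ m'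
encode-injective M (inj₁ v) (inj₁ v') _ _ e = cong inj₁ e
encode-injective M (inj₁ v) (inj₂ i) p _ refl = ⊥-elim (<⇒≱ (s≤s (m≤m+n M i)) p)
encode-injective M (inj₂ i) (inj₁ v) _ p refl = ⊥-elim (<⇒≱ (s≤s (m≤m+n M i)) p)
encode-injective M (inj₂ i) (inj₂ i') _ _ e = cong inj₂ (+-cancelˡ-≡ M _ _ (suc-injective e))

length-take-≤ : ∀ k (xs : Word) → k ≤ length xs → length (take k xs) ≡ k
length-take-≤ k xs p = trans (length-take k xs) (m≤n⇒m⊓n≡m p)

at-++ʳ′ : ∀ xs ys k i → length xs ≡ k → at (xs ++ ys) (k + i) ≡ at ys i
at-++ʳ′ xs ys k i refl = at-++ʳ xs ys i

module InsertAt (K : Kind) (w : Word) (ν s e : ℕ) where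
  M : ℕ
  M = maxSym w
  u y₁ y₂ y₃ : Word
  u = block M ν
  y₁ = take s w
  y₂ = take e (drop s w)
  y₃ = drop (s + e) w

  length-u′ : length (second K u) ≡ ν
  length-u′ = trans (length-second K u) (length-block M ν)

module Pieces (w : Word) (s e f : ℕ) (L : length w ≡ s + e + f) where
  s≤n : s ≤ length w
  s≤n = subst (s ≤_) (sym L) (≤-trans (m≤m+n s e) (m≤m+n (s + e) f))

  length-prefix : length (take s w) ≡ s
  length-prefix = length-take-≤ s w s≤n

  length-middle : length (take e (drop s w)) ≡ e
  length-middle = length-take-≤ e (drop s w) (subst (e ≤_) (sym length-rest) (m≤m+n e f))
    where
    length-rest : length (drop s w) ≡ e + f
    length-rest = trans (length-drop s w) (trans (cong (_∸ s) L) (trans (cong (_∸ s) (+-assoc s e f)) (m+n∸m≡n s (e + f))))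

  length-suffix : length (drop (s + e) w) ≡ f
  length-suffix = trans (length-drop (s + e) w) (trans (cong (_∸ (s + e)) L) (m+n∸m≡n (s + e) f))

-- The inserted symbols maxSym w + 1, …, maxSym w + ν exceed every letter of w, so positions of
-- insertAt carry equal symbols exactly when they have equal meanings (insertAt-pattern).
at-insertAt : ∀ K w ν s e f {x} → length w ≡ s + e + f → (c : Slot s e f ν x) →
  (at (insertAt K w ν s e) x ≡ encode (maxSym w) (meaning K w c)) × Encodable (maxSym w) (meaning K w c)
at-insertAt K w ν s e f L (pre j p refl) =
  trans (at-++ˡ y₁ _ j (subst (j <_) (sym length-prefix) p)) (at-take s w j p) , at≤maxSym w j (≤-trans p s≤n)
  where open Pieces w s e f L; open InsertAt K w ν s e
at-insertAt K w ν s e f L (blk₁ i p refl) =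
  trans (at-++ʳ′ y₁ _ s i length-prefix) (trans (at-++ˡ u _ i (subst (i <_) (sym (length-block M ν)) p)) (at-block M ν i p)) , tt
  where open Pieces w s e f L; open InsertAt K w ν s e
at-insertAt K w ν s e f L (mid j p refl) =
  trans (at-++ʳ′ y₁ _ s _ length-prefix) (trans (at-++ʳ′ u _ ν j (length-block M ν))
    (trans (at-++ˡ y₂ _ j (subst (j <_) (sym length-middle) p)) (trans (at-take e (drop s w) j p) (at-drop s w j))))
  , at≤maxSym w (s + j) (subst (s + j <_) (sym L) (≤-trans (+-monoʳ-< s p) (m≤m+n (s + e) f)))
  where open Pieces w s e f L; open InsertAt K w ν s e
at-insertAt K w ν s e f L (blk₂ i p refl) =
  trans (at-++ʳ′ y₁ _ s _ length-prefix) (trans (at-++ʳ′ u _ ν _ (length-block M ν)) (trans (at-++ʳ′ y₂ _ e i length-middle)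
    (trans (at-++ˡ (second K u) _ i (subst (i <_) (sym length-u′) p)) (at-second K M ν i p)))) , tt
  where open Pieces w s e f L; open InsertAt K w ν s e
at-insertAt K w ν s e f L (suf j p refl) =
  trans (at-++ʳ′ y₁ _ s _ length-prefix) (trans (at-++ʳ′ u _ ν _ (length-block M ν)) (trans (at-++ʳ′ y₂ _ e _ length-middle)
    (trans (at-++ʳ′ (second K u) _ ν j length-u′) (at-drop (s + e) w j))))
  , at≤maxSym w (s + e + j) (subst (s + e + j <_) (sym L) (+-monoʳ-< (s + e) p))
  where open Pieces w s e f L; open InsertAt K w ν s e

length-insertAt : ∀ K w ν s e f → length w ≡ s + e + f → length (insertAt K w ν s e) ≡ slotCount s e f ν
length-insertAt K w ν s e f L = begin
  length (y₁ ++ u ++ y₂ ++ second K u ++ y₃)                    ≡⟨ length-++ y₁ ⟩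
  length y₁ + length (u ++ y₂ ++ second K u ++ y₃)              ≡⟨ cong (length y₁ +_) (length-++ u) ⟩
  length y₁ + (length u + length (y₂ ++ second K u ++ y₃))      ≡⟨ cong (λ z → length y₁ + (length u + z)) (length-++ y₂) ⟩
  length y₁ + (length u + (length y₂ + length (second K u ++ y₃))) ≡⟨ cong (λ z → length y₁ + (length u + (length y₂ + z))) (length-++ (second K u)) ⟩
  length y₁ + (length u + (length y₂ + (length (second K u) + length y₃)))
    ≡⟨ cong₂ (λ a b → a + (length u + b)) length-prefix (cong₂ (λ b c → b + (length (second K u) + c)) length-middle length-suffix) ⟩
  s + (length u + (e + (length (second K u) + f)))              ≡⟨ cong₂ (λ a b → s + (a + (e + (b + f)))) (length-block M ν) length-u′ ⟩
  slotCount s e f ν                                             ∎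
  where
  open ≡-Reasoning
  open Pieces w s e f L
  open InsertAt K w ν s e

insertAt-pattern : ∀ K w ν s e f {x x'} → length w ≡ s + e + f → (c : Slot s e f ν x) (c' : Slot s e f ν x') →
  (at (insertAt K w ν s e) x ≡ at (insertAt K w ν s e) x') ⇔ (meaning K w c ≡ meaning K w c')
insertAt-pattern K w ν s e f L c c' =
  (λ eq → encode-injective M _ _ (proj₂ l) (proj₂ l') (trans (sym (proj₁ l)) (trans eq (proj₁ l'))))
  , (λ eq → trans (proj₁ l) (trans (cong (encode M) eq) (sym (proj₁ l'))))
  where
  M = maxSym w
  l = at-insertAt K w ν s e f L c
  l' = at-insertAt K w ν s e f L c'

module _ (K : Kind) (w : Word) (ν s e f : ℕ) (L : length w ≡ s + e + f) where
  private
    I : Word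
    I = insertAt K w ν s e
    N : ℕ
    N = slotCount s e f ν

  block₁-partners : ∀ i {x'} → i < ν → x' < N → at I (s + i) ≡ at I x' → (x' ≡ s + i) ⊎ (x' ≡ s + (ν + (e + partner K ν i)))
  block₁-partners i {x'} p q eq with slot s e f ν x' q
  ... | c' with proj₁ (insertAt-pattern K w ν s e f L (blk₁ i p refl) c') eq
  block₁-partners i p q eq | pre j _ _ | ()
  block₁-partners i p q eq | blk₁ i' _ refl | refl = inj₁ refl
  block₁-partners i p q eq | mid j _ _ | ()
  block₁-partners i p q eq | blk₂ i' p' refl | e' = inj₂ (cong (λ z → s + (ν + (e + z))) (trans (sym (partner-involutive K ν i' p')) (cong (partner K ν) (sym (inj₂-injective e')))))
  block₁-partners i p q eq | suf j _ _ | ()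

  block₂-partners : ∀ i {x'} → i < ν → x' < N → at I (s + (ν + (e + i))) ≡ at I x' → (x' ≡ s + (ν + (e + i))) ⊎ (x' ≡ s + partner K ν i)
  block₂-partners i {x'} p q eq with slot s e f ν x' q
  ... | c' with proj₁ (insertAt-pattern K w ν s e f L (blk₂ i p refl) c') eq
  block₂-partners i p q eq | pre j _ _ | ()
  block₂-partners i p q eq | blk₁ i' _ refl | refl = inj₂ refl
  block₂-partners i p q eq | mid j _ _ | ()
  block₂-partners i p q eq | blk₂ i' p' refl | e' = inj₁ (cong (λ z → s + (ν + (e + z))) (sym (partner-injective K ν i i' p p' (inj₂-injective e'))))
  block₂-partners i p q eq | suf j _ _ | ()

  block₁≡block₂ : ∀ i → i < ν → at I (s + i) ≡ at I (s + (ν + (e + partner K ν i)))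
  block₁≡block₂ i p = proj₂ (insertAt-pattern K w ν s e f L (blk₁ i p refl) (blk₂ (partner K ν i) (partner< K ν i p) refl)) (cong inj₂ (sym (partner-involutive K ν i p)))

  at-insertAt-pre : ∀ j → j < s → at I j ≡ at w j
  at-insertAt-pre j p = proj₁ (at-insertAt K w ν s e f L (pre j p refl))

  at-insertAt-mid : ∀ j → j < e → at I (s + (ν + j)) ≡ at w (s + j)
  at-insertAt-mid j p = proj₁ (at-insertAt K w ν s e f L (mid j p refl))

  at-insertAt-suf : ∀ j → j < f → at I (s + (ν + (e + (ν + j)))) ≡ at w (s + e + j)
  at-insertAt-suf j p = proj₁ (at-insertAt K w ν s e f L (suf j p refl))

InRange : ℕ → Origin → Set
InRange n (fromWord j) = j < n
InRange n (fromBlock _) = ⊤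

origin-inRange : ∀ K {s e f ν x} → (c : Slot s e f ν x) → InRange (s + e + f) (origin K c)
origin-inRange K {s} {e} {f} (pre j p _) = ≤-trans p (≤-trans (m≤m+n s e) (m≤m+n (s + e) f))
origin-inRange K (blk₁ _ _ _) = tt
origin-inRange K {s} {e} {f} (mid j p _) = ≤-trans (+-monoʳ-< s p) (m≤m+n (s + e) f)
origin-inRange K (blk₂ _ _ _) = tt
origin-inRange K {s} {e} {f} (suf j p _) = +-monoʳ-< (s + e) p

interpret-transfer : ∀ {x y} → SamePattern x y → ∀ k k' → InRange (length x) k → InRange (length x) k' → interpret x k ≡ interpret x k' → interpret y k ≡ interpret y k'
interpret-transfer P (fromWord j) (fromWord j') b b' eq = cong inj₁ (preserves P j j' b b' (inj₁-injective eq))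
interpret-transfer P (fromWord j) (fromBlock i) b b' ()
interpret-transfer P (fromBlock i) (fromWord j) b b' ()
interpret-transfer P (fromBlock i) (fromBlock i') b b' eq = eq

insertAt-cong : ∀ K x y ν s e f → length x ≡ s + e + f → SamePattern x y → SamePattern (insertAt K x ν s e) (insertAt K y ν s e)
insertAt-cong K x y ν s e f L P = record
  { length≡ = trans (length-insertAt K x ν s e f L) (sym (length-insertAt K y ν s e f Ly))
  ; preserves = λ i j a b eq → preserved x y L Ly P i j a b eq
  ; reflects = λ i j a b eq → preserved y x Ly L (SamePattern-sym P) i j (subst (i <_) lx≡ a) (subst (j <_) lx≡ b) eq }
  where
  Ly : length y ≡ s + e + f
  Ly = trans (sym (length≡ P)) L
  lx≡ : length (insertAt K x ν s e) ≡ length (insertAt K y ν s e)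
  lx≡ = trans (length-insertAt K x ν s e f L) (sym (length-insertAt K y ν s e f Ly))
  preserved : ∀ x y → length x ≡ s + e + f → length y ≡ s + e + f → SamePattern x y → ∀ i j → i < length (insertAt K x ν s e) → j < length (insertAt K x ν s e) →
       at (insertAt K x ν s e) i ≡ at (insertAt K x ν s e) j → at (insertAt K y ν s e) i ≡ at (insertAt K y ν s e) j
  preserved x y Lx Ly P i j a b eq =
    proj₂ (insertAt-pattern K y ν s e f Ly ci cj)
      (interpret-transfer P (origin K ci) (origin K cj) (kb ci) (kb cj) (proj₁ (insertAt-pattern K x ν s e f Lx ci cj) eq))
    where
    ci = slot s e f ν i (subst (i <_) (length-insertAt K x ν s e f Lx) a)
    cj = slot s e f ν j (subst (j <_) (length-insertAt K x ν s e f Lx) b)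
    kb : ∀ {z} (c : Slot s e f ν z) → InRange (length x) (origin K c)
    kb c = subst (λ m → InRange m (origin K c)) (sym Lx) (origin-inRange K c)

meaning-unique : ∀ K w ν s e f {y y'} → length w ≡ s + e + f → y ≡ y' → (c : Slot s e f ν y) (c' : Slot s e f ν y') → meaning K w c ≡ meaning K w c'
meaning-unique K w ν s e f L refl c c' = proj₁ (insertAt-pattern K w ν s e f L c c') refl

slot-bound : ∀ {s e f ν x} → Slot s e f ν x → x < slotCount s e f ν
slot-bound {s} {e} {f} {ν} (pre j p refl) = ≤-trans p (m≤m+n s _)
slot-bound {s} {e} {f} {ν} (blk₁ i p refl) = +-monoʳ-< s (≤-trans p (m≤m+n ν _))
slot-bound {s} {e} {f} {ν} (mid j p refl) = +-monoʳ-< s (+-monoʳ-< ν (≤-trans p (m≤m+n e _)))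
slot-bound {s} {e} {f} {ν} (blk₂ i p refl) = +-monoʳ-< s (+-monoʳ-< ν (+-monoʳ-< e (≤-trans p (m≤m+n ν _))))
slot-bound {s} {e} {f} {ν} (suf j p refl) = +-monoʳ-< s (+-monoʳ-< ν (+-monoʳ-< e (+-monoʳ-< ν p)))

deleteBlocks : ℕ → Word → ℕ → ℕ → Word
deleteBlocks ν w s m = take s w ++ take m (drop (s + ν) w)

module Deletion (K : Kind) (w : Word) (ν s m : ℕ) (L : length w ≡ slotCount s m 0 ν) where
  w₀ : Word
  w₀ = deleteBlocks ν w s m

  n : ℕ
  n = slotCount s m 0 ν

  s≤n : s ≤ length w
  s≤n = subst (s ≤_) (sym L) (m≤m+n s _)

  ld : length (drop (s + ν) w) ≡ m + ν
  ld = trans (length-drop (s + ν) w) (trans (cong (_∸ (s + ν)) L) (trans (cong (_∸ (s + ν)) (e1 s ν m)) (m+n∸m≡n (s + ν) (m + ν))))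
    where
    e1 : ∀ s ν m → s + (ν + (m + (ν + 0))) ≡ s + ν + (m + ν)
    e1 = solve-∀

  l1 : length (take s w) ≡ s
  l1 = length-take-≤ s w s≤n

  L₀ : length w₀ ≡ s + m + 0
  L₀ = trans (length-++ (take s w)) (trans (cong₂ _+_ l1 (length-take-≤ m _ (subst (m ≤_) (sym ld) (m≤m+n m ν)))) (sym (+-identityʳ _)))

  at-deleted-pre : ∀ j → j < s → at w₀ j ≡ at w j
  at-deleted-pre j p = trans (at-++ˡ (take s w) _ j (subst (j <_) (sym l1) p)) (at-take s w j p)

  at-deleted-mid : ∀ j → j < m → at w₀ (s + j) ≡ at w (s + (ν + j))
  at-deleted-mid j p = trans (at-++ʳ′ (take s w) _ s j l1) (trans (at-take m _ j p) (trans (at-drop (s + ν) w j) (cong (at w) (+-assoc s ν j))))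

  B₀ : Word
  B₀ = insertAt K w₀ ν s m

  BlocksPaired : Set
  BlocksPaired = ∀ i → i < ν → ∀ y → y < n → (at w (s + i) ≡ at w y) ⇔ ((y ≡ s + i) ⊎ (y ≡ s + (ν + (m + partner K ν i))))

  data IsBlock {y} : Slot s m 0 ν y → Set where
    isBlk₁ : ∀ {i p q} → IsBlock (blk₁ i p q)
    isBlk₂ : ∀ {i p q} → IsBlock (blk₂ i p q)
  data IsLetter {y} : Slot s m 0 ν y → Set where
    isPre : ∀ {j p q} → IsLetter (pre j p q)
    isMid : ∀ {j p q} → IsLetter (mid j p q)

  block-or-letter : ∀ {y} (c : Slot s m 0 ν y) → IsBlock c ⊎ IsLetter c
  block-or-letter (pre _ _ _) = inj₂ isPre
  block-or-letter (blk₁ _ _ _) = inj₁ isBlk₁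
  block-or-letter (mid _ _ _) = inj₂ isMid
  block-or-letter (blk₂ _ _ _) = inj₁ isBlk₂
  block-or-letter (suf _ () _)

  module _ (blocksPaired : BlocksPaired) where
    block-pattern : ∀ {x} (cx : Slot s m 0 ν x) → IsBlock cx → ∀ {y} → y < n → (cy : Slot s m 0 ν y) → (at w x ≡ at w y) ⇔ (meaning K w₀ cy ≡ meaning K w₀ cx)
    block-pattern (blk₁ i p refl) isBlk₁ {y} yn cy = to , from
      where
      to : at w (s + i) ≡ at w y → meaning K w₀ cy ≡ inj₂ i
      to eq with proj₁ (blocksPaired i p y yn) eq
      ... | inj₁ e = meaning-unique K w₀ ν s m 0 L₀ e cy (blk₁ i p refl)
      ... | inj₂ e = trans (meaning-unique K w₀ ν s m 0 L₀ e cy (blk₂ (partner K ν i) (partner< K ν i p) refl)) (cong inj₂ (partner-involutive K ν i p))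
      from' : ∀ {y} → y < n → (cy : Slot s m 0 ν y) → meaning K w₀ cy ≡ inj₂ i → at w (s + i) ≡ at w y
      from' yn (pre _ _ _) ()
      from' yn (blk₁ i' _ refl) eq = cong (λ z → at w (s + z)) (sym (inj₂-injective eq))
      from' yn (mid _ _ _) ()
      from' yn (blk₂ i' p' refl) eq = proj₂ (blocksPaired i p _ yn) (inj₂ (cong (λ z → s + (ν + (m + z))) (trans (sym (partner-involutive K ν i' p')) (cong (partner K ν) (inj₂-injective eq)))))
      from' yn (suf _ () _) eq
      from : meaning K w₀ cy ≡ inj₂ i → at w (s + i) ≡ at w y
      from = from' yn cy
    block-pattern (blk₂ i p refl) isBlk₂ {y} yn cy = to , from
      where
      i₀ = partner K ν i
      p₀ = partner< K ν i p
      xn : s + (ν + (m + i)) < n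
      xn = +-monoʳ-< s (+-monoʳ-< ν (+-monoʳ-< m (subst (i <_) (sym (+-identityʳ ν)) p)))
      link : at w (s + i₀) ≡ at w (s + (ν + (m + i)))
      link = proj₂ (blocksPaired i₀ p₀ _ xn) (inj₂ (cong (λ z → s + (ν + (m + z))) (sym (partner-involutive K ν i p))))
      to : at w (s + (ν + (m + i))) ≡ at w y → meaning K w₀ cy ≡ inj₂ i₀
      to eq = proj₁ (block-pattern (blk₁ i₀ p₀ refl) isBlk₁ yn cy) (trans link eq)
      from : meaning K w₀ cy ≡ inj₂ i₀ → at w (s + (ν + (m + i))) ≡ at w y
      from eq = trans (sym link) (proj₂ (block-pattern (blk₁ i₀ p₀ refl) isBlk₁ yn cy) eq)

    letter-meaning : ∀ {x} (cx : Slot s m 0 ν x) → IsLetter cx → meaning K w₀ cx ≡ inj₁ (at w x)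
    letter-meaning (pre j p refl) isPre = cong inj₁ (at-deleted-pre j p)
    letter-meaning (mid j p refl) isMid = cong inj₁ (at-deleted-mid j p)

    at-pattern : ∀ x y → x < n → y < n → (at w x ≡ at w y) ⇔ (at B₀ x ≡ at B₀ y)
    at-pattern x y xn yn with slot s m 0 ν x xn | slot s m 0 ν y yn
    ... | cx | cy = go (block-or-letter cx) (block-or-letter cy)
      where
      E = insertAt-pattern K w₀ ν s m 0 L₀ cx cy
      go : IsBlock cx ⊎ IsLetter cx → IsBlock cy ⊎ IsLetter cy → (at w x ≡ at w y) ⇔ (at B₀ x ≡ at B₀ y)
      go (inj₁ bx) _ = (λ eq → proj₂ E (sym (proj₁ (block-pattern cx bx yn cy) eq))) , (λ eq → proj₂ (block-pattern cx bx yn cy) (sym (proj₁ E eq)))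
      go (inj₂ rx) (inj₁ by) = (λ eq → proj₂ E (proj₁ (block-pattern cy by xn cx) (sym eq))) , (λ eq → sym (proj₂ (block-pattern cy by xn cx) (proj₁ E eq)))
      go (inj₂ rx) (inj₂ ry) = (λ eq → proj₂ E (trans (letter-meaning cx rx) (trans (cong inj₁ eq) (sym (letter-meaning cy ry)))))
                             , (λ eq → inj₁-injective (trans (sym (letter-meaning cx rx)) (trans (proj₁ E eq) (letter-meaning cy ry))))

    reinsertion : SamePattern w B₀
    reinsertion = record { length≡ = trans L (sym (length-insertAt K w₀ ν s m 0 L₀))
                ; preserves = λ i j a b → proj₁ (at-pattern i j (subst (i <_) L a) (subst (j <_) L b))
                ; reflects = λ i j a b → proj₂ (at-pattern i j (subst (i <_) L a) (subst (j <_) L b)) }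

take-prefix : ∀ (xs ys : Word) k → length xs ≡ k → take k (xs ++ ys) ≡ xs
take-prefix [] ys zero refl = refl
take-prefix (x ∷ xs) ys (suc k) refl = cong (x ∷_) (take-prefix xs ys k refl)

drop-prefix : ∀ (xs ys : Word) k → length xs ≡ k → drop k (xs ++ ys) ≡ ys
drop-prefix [] ys zero refl = refl
drop-prefix (x ∷ xs) ys (suc k) refl = drop-prefix xs ys k refl

maxSym-++ : ∀ xs ys → maxSym (xs ++ ys) ≡ maxSym xs ⊔ maxSym ys
maxSym-++ [] ys = refl
maxSym-++ (x ∷ xs) ys = trans (cong (x ⊔_) (maxSym-++ xs ys)) (sym (⊔-assoc x (maxSym xs) (maxSym ys)))

maxSym-reverse : ∀ xs → maxSym (reverse xs) ≡ maxSym xs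
maxSym-reverse [] = refl
maxSym-reverse (x ∷ xs) = begin
  maxSym (reverse (x ∷ xs)) ≡⟨ cong maxSym (unfold-reverse x xs) ⟩
  maxSym (reverse xs ++ x ∷ []) ≡⟨ maxSym-++ (reverse xs) (x ∷ []) ⟩
  maxSym (reverse xs) ⊔ (x ⊔ 0) ≡⟨ cong₂ _⊔_ (maxSym-reverse xs) (⊔-identityʳ x) ⟩
  maxSym xs ⊔ x ≡⟨ ⊔-comm (maxSym xs) x ⟩
  x ⊔ maxSym xs ∎
  where open ≡-Reasoning

applyUpTo-cong : ∀ (f g : ℕ → ℕ) n → (∀ i → f i ≡ g i) → applyUpTo f n ≡ applyUpTo g n
applyUpTo-cong f g zero h = refl
applyUpTo-cong f g (suc n) h = cong₂ _∷_ (h 0) (applyUpTo-cong (λ i → f (suc i)) (λ i → g (suc i)) n (λ i → h (suc i)))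

applyUpTo-+ : ∀ (f : ℕ → ℕ) k l → applyUpTo f (k + l) ≡ applyUpTo f k ++ applyUpTo (λ i → f (k + i)) l
applyUpTo-+ f zero l = refl
applyUpTo-+ f (suc k) l = cong (f 0 ∷_) (applyUpTo-+ (λ i → f (suc i)) k l)

block-+ : ∀ M k l → block M (k + l) ≡ block M k ++ block (M + k) l
block-+ M k l = trans (applyUpTo-+ _ k l) (cong (block M k ++_) (applyUpTo-cong _ _ l (λ i → cong suc (sym (+-assoc M k i)))))

block-suc : ∀ M k → block M (suc k) ≡ block M k ++ (suc (M + k) ∷ [])
block-suc M k = trans (cong (block M) (+-comm 1 k)) (trans (block-+ M k 1) (cong (λ z → block M k ++ (suc z ∷ [])) (+-identityʳ (M + k))))

maxSym-block≤ : ∀ M k → maxSym (block M k) ≤ M + k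
maxSym-block≤ M zero = z≤n
maxSym-block≤ M (suc k) = subst (_≤ M + suc k) (sym (trans (cong maxSym (block-suc M k)) (maxSym-++ (block M k) _)))
  (⊔-lub (≤-trans (maxSym-block≤ M k) (≤-trans (n≤1+n _) (≤-reflexive (sym (+-suc M k))))) (⊔-lub (≤-reflexive (sym (+-suc M k))) z≤n))

maxSym-block : ∀ M k → maxSym (block M (suc k)) ≡ M + suc k
maxSym-block M k = begin
  maxSym (block M (suc k)) ≡⟨ cong maxSym (block-suc M k) ⟩
  maxSym (block M k ++ (suc (M + k) ∷ [])) ≡⟨ maxSym-++ (block M k) _ ⟩
  maxSym (block M k) ⊔ (suc (M + k) ⊔ 0) ≡⟨ cong (maxSym (block M k) ⊔_) (⊔-identityʳ _) ⟩
  maxSym (block M k) ⊔ suc (M + k) ≡⟨ m≤n⇒m⊔n≡n (≤-trans (maxSym-block≤ M k) (n≤1+n _)) ⟩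
  suc (M + k) ≡⟨ sym (+-suc M k) ⟩
  M + suc k ∎
  where open ≡-Reasoning

maxSym-block0 : ∀ k → maxSym (block 0 k) ≡ k
maxSym-block0 zero = refl
maxSym-block0 (suc k) = maxSym-block 0 k

maxSym-s₀ : ∀ m → maxSym (s₀ m) ≡ m
maxSym-s₀ m = trans (maxSym-++ (applyUpTo suc m) (applyUpTo suc m)) (trans (⊔-idem _) (maxSym-block0 m))

s₀-insertAt : ∀ m ν → insertAt rep (s₀ m) ν m m ≡ s₀ (m + ν)
s₀-insertAt m ν = begin
  take m (X ++ X) ++ u ++ take m (drop m (X ++ X)) ++ u ++ drop (m + m) (X ++ X)
    ≡⟨ cong₂ (λ p q → p ++ u ++ q ++ u ++ drop (m + m) (X ++ X)) (take-prefix X X m lX) (trans (cong (take m) (drop-prefix X X m lX)) (take-all m X (≤-reflexive lX))) ⟩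
  X ++ u ++ X ++ u ++ drop (m + m) (X ++ X)
    ≡⟨ cong (λ q → X ++ u ++ X ++ u ++ q) (drop-all (m + m) (X ++ X) (≤-reflexive (trans (length-++ X) (cong₂ _+_ lX lX)))) ⟩
  X ++ u ++ X ++ u ++ []
    ≡⟨ cong (λ q → X ++ u ++ X ++ q) (++-identityʳ u) ⟩
  X ++ u ++ X ++ u
    ≡⟨ sym (++-assoc X u (X ++ u)) ⟩
  (X ++ u) ++ (X ++ u)
    ≡⟨ cong (λ z → (X ++ z) ++ (X ++ z)) (cong (λ M → block M ν) (maxSym-s₀ m)) ⟩
  (X ++ block m ν) ++ (X ++ block m ν)
    ≡⟨ cong (λ z → z ++ z) (sym (block-+ 0 m ν)) ⟩
  s₀ (m + ν) ∎
  where
  open ≡-Reasoning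
  X = applyUpTo suc m
  lX : length X ≡ m
  lX = length-applyUpTo suc m
  u = block (maxSym (s₀ m)) ν

concat-applyUpTo-suc : ∀ (g : ℕ → Word) h → concat (applyUpTo g (suc h)) ≡ concat (applyUpTo g h) ++ g h
concat-applyUpTo-suc g h = begin
  concat (applyUpTo g (suc h)) ≡⟨ cong concat (sym (applyUpTo-∷ʳ g h)) ⟩
  concat (applyUpTo g h ++ g h ∷ []) ≡⟨ sym (concat-++ (applyUpTo g h) (g h ∷ [])) ⟩
  concat (applyUpTo g h) ++ (g h ++ []) ≡⟨ cong (concat (applyUpTo g h) ++_) (++-identityʳ (g h)) ⟩
  concat (applyUpTo g h) ++ g h ∎
  where open ≡-Reasoning

length-concat-applyUpTo : ∀ (g : ℕ → Word) ν → (∀ i → length (g i) ≡ ν) → ∀ h → length (concat (applyUpTo g h)) ≡ h * ν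
length-concat-applyUpTo g ν G zero = refl
length-concat-applyUpTo g ν G (suc h) = trans (cong length (concat-applyUpTo-suc g h)) (trans (length-++ (concat (applyUpTo g h)))
  (trans (cong₂ _+_ (length-concat-applyUpTo g ν G h) (G h)) (+-comm (h * ν) ν)))

maxSym-concat-applyUpTo : ∀ (g : ℕ → Word) ν → (∀ i → maxSym (g i) ≡ i * ν + ν) → ∀ h → maxSym (concat (applyUpTo g h)) ≡ h * ν
maxSym-concat-applyUpTo g ν G zero = refl
maxSym-concat-applyUpTo g ν G (suc h) = trans (cong maxSym (concat-applyUpTo-suc g h)) (trans (maxSym-++ (concat (applyUpTo g h)) (g h))
  (trans (cong₂ _⊔_ (maxSym-concat-applyUpTo g ν G h) (G h)) (trans (m≤n⇒m⊔n≡n (m≤m+n (h * ν) ν)) (+-comm (h * ν) ν))))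

module IntBlocks (ν' : ℕ) where
  ν : ℕ
  ν = suc ν'
  gP : ℕ → Word
  gP i = block (i * ν) ν
  gQ : ℕ → Word
  gQ i = reverse (block (i * ν) ν)
  P : ℕ → Word
  P h = concat (applyUpTo gP h)
  Q : ℕ → Word
  Q h = concat (applyUpTo gQ h)
  lP : ∀ h → length (P h) ≡ h * ν
  lP = length-concat-applyUpTo gP ν (λ i → length-block (i * ν) ν)
  lQ : ∀ h → length (Q h) ≡ h * ν
  lQ = length-concat-applyUpTo gQ ν (λ i → trans (length-reverse (block (i * ν) ν)) (length-block (i * ν) ν))
  mP : ∀ h → maxSym (P h) ≡ h * ν
  mP = maxSym-concat-applyUpTo gP ν (λ i → maxSym-block (i * ν) ν')
  mQ : ∀ h → maxSym (Q h) ≡ h * ν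
  mQ = maxSym-concat-applyUpTo gQ ν (λ i → trans (maxSym-reverse (block (i * ν) ν)) (maxSym-block (i * ν) ν'))

  Int-insertAt : ∀ h → insertAt ret (Int h ν) ν (h * ν) (h * ν) ≡ Int (suc h) ν
  Int-insertAt h = begin
    take k (P h ++ Q h) ++ u ++ take k (drop k (P h ++ Q h)) ++ reverse u ++ drop (k + k) (P h ++ Q h)
      ≡⟨ cong₂ (λ p q → p ++ u ++ q ++ reverse u ++ drop (k + k) (P h ++ Q h)) (take-prefix (P h) (Q h) k (lP h)) (trans (cong (take k) (drop-prefix (P h) (Q h) k (lP h))) (take-all k (Q h) (≤-reflexive (lQ h)))) ⟩
    P h ++ u ++ Q h ++ reverse u ++ drop (k + k) (P h ++ Q h)
      ≡⟨ cong (λ q → P h ++ u ++ Q h ++ reverse u ++ q) (drop-all (k + k) (P h ++ Q h) (≤-reflexive (trans (length-++ (P h)) (cong₂ _+_ (lP h) (lQ h))))) ⟩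
    P h ++ u ++ Q h ++ reverse u ++ []
      ≡⟨ cong (λ q → P h ++ u ++ Q h ++ q) (++-identityʳ (reverse u)) ⟩
    P h ++ u ++ Q h ++ reverse u
      ≡⟨ sym (++-assoc (P h) u (Q h ++ reverse u)) ⟩
    (P h ++ u) ++ (Q h ++ reverse u)
      ≡⟨ cong (λ z → (P h ++ block z ν) ++ (Q h ++ reverse (block z ν))) mx ⟩
    (P h ++ gP h) ++ (Q h ++ gQ h)
      ≡⟨ sym (cong₂ _++_ (concat-applyUpTo-suc gP h) (concat-applyUpTo-suc gQ h)) ⟩
    Int (suc h) ν ∎
    where
    open ≡-Reasoning
    k = h * ν
    u = block (maxSym (Int h ν)) ν
    mx : maxSym (Int h ν) ≡ h * ν
    mx = trans (maxSym-++ (P h) (Q h)) (trans (cong₂ _⊔_ (mP h) (mQ h)) (⊔-idem _))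

MatchesT : Kind → Kind → ℕ → ℕ → ℕ → Word → Set
MatchesT rep rep ν a p w = SamePattern w (iterT rep ν a p (s₀ a))
MatchesT ret ret ν a p w = Σ ℕ λ h → (a ≡ h * ν) × SamePattern w (iterT ret ν a p (Int h ν))
MatchesT rep ret ν a p w = ⊤
MatchesT ret rep ν a p w = ⊤

iterT-insertAt : ∀ K T ν m s → length T ≡ s + m → insert K T ν (length T ∸ m + 1) (length T + 1) ≡ insertAt K T ν s m
iterT-insertAt K T ν m s e = trans (cong₂ (insert K T ν) e1 e2) (insert≡insertAt K T ν s m)
  where
  e1 : length T ∸ m + 1 ≡ suc s
  e1 = trans (cong (λ z → z ∸ m + 1) e) (trans (cong (_+ 1) (m+n∸n≡m s m)) (+-comm s 1))
  e2 : length T + 1 ≡ suc (s + m)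
  e2 = trans (cong (_+ 1) e) (+-comm (s + m) 1)

SamePattern-via-insertAt : ∀ K w w₀ T ν s e → SamePattern w (insertAt K w₀ ν s e) → SamePattern w₀ T → length w₀ ≡ s + e →
  SamePattern w (insertAt K T ν s e)
SamePattern-via-insertAt K w w₀ T ν s e R G L₀ = SamePattern-trans R (insertAt-cong K w₀ T ν s e 0 (trans L₀ (sym (+-identityʳ _))) G)

MatchesT-step : ∀ K₁ K₂ ν a p₀ w w₀ s → MatchesT K₁ K₂ ν a p₀ w₀ → SamePattern w (insertAt K₂ w₀ ν s a) →
  length w₀ ≡ s + a → MatchesT K₁ K₂ ν a (suc p₀) w
MatchesT-step rep rep ν a p₀ w w₀ s G R L₀ =
  subst (SamePattern w) (sym (iterT-insertAt rep T₀ ν a s (trans (sym (length≡ G)) L₀))) (SamePattern-via-insertAt rep w w₀ T₀ ν s a R G L₀)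
  where
  T₀ : Word
  T₀ = iterT rep ν a p₀ (s₀ a)
MatchesT-step ret ret ν a p₀ w w₀ s (h , a≡hν , G) R L₀ =
  h , a≡hν , subst (SamePattern w) (sym (iterT-insertAt ret T₀ ν a s (trans (sym (length≡ G)) L₀))) (SamePattern-via-insertAt ret w w₀ T₀ ν s a R G L₀)
  where
  T₀ : Word
  T₀ = iterT ret ν a p₀ (Int h ν)
MatchesT-step rep ret ν a p₀ w w₀ s G R L₀ = tt
MatchesT-step ret rep ν a p₀ w w₀ s G R L₀ = tt

MatchesT-base : ∀ K₁ K₂ ν' a' w w₀ → MatchesT K₁ K₂ (suc ν') a' 0 w₀ → SamePattern w (insertAt K₂ w₀ (suc ν') a' a') →
  length w₀ ≡ a' + a' → MatchesT K₁ K₂ (suc ν') (suc ν' + a') 0 w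
MatchesT-base rep rep ν' a' w w₀ G R L₀ =
  subst (SamePattern w) (trans (s₀-insertAt a' (suc ν')) (cong s₀ (+-comm a' (suc ν')))) (SamePattern-via-insertAt rep w w₀ (s₀ a') (suc ν') a' a' R G L₀)
MatchesT-base ret ret ν' a' w w₀ (h , refl , G) R L₀ =
  suc h , refl , subst (SamePattern w) (IntBlocks.Int-insertAt ν' h) (SamePattern-via-insertAt ret w w₀ (Int h (suc ν')) (suc ν') _ _ R G L₀)
MatchesT-base rep ret ν' a' w w₀ G R L₀ = tt
MatchesT-base ret rep ν' a' w w₀ G R L₀ = tt

module Overlap (K₁ K₂ : Kind) (ν : ℕ) (w : Word) (a d c : ℕ) (L : length w ≡ a + d + c) where
  A B : Word
  A = insertAt K₁ w ν 0 a
  B = insertAt K₂ w ν (a + d) c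
  LA : length w ≡ 0 + a + (d + c)
  LA = trans L (+-assoc a d c)
  LB : length w ≡ a + d + c + 0
  LB = trans L (sym (+-identityʳ _))
  NA NB : ℕ
  NA = slotCount 0 a (d + c) ν
  NB = slotCount (a + d) c 0 ν
  NA≡NB : NA ≡ NB
  NA≡NB = e a d c ν
    where
    e : ∀ a d c ν → ν + (a + (ν + (d + c))) ≡ a + d + (ν + (c + (ν + 0)))
    e = solve-∀
  lenA : length A ≡ NA
  lenA = length-insertAt K₁ w ν 0 a (d + c) LA
  sB : ℕ
  sB = a + d

  toNB : ∀ {x} → x < NA → x < NB
  toNB {x} = subst (x <_) NA≡NB
  toNA : ∀ {x} → x < NB → x < NA
  toNA {x} = subst (x <_) (sym NA≡NB)

  module _ (H : SamePattern A B) where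
    AtoB : ∀ {x y} → x < NA → y < NA → at A x ≡ at A y → at B x ≡ at B y
    AtoB {x} {y} p q = preserves H x y (subst (x <_) (sym lenA) p) (subst (y <_) (sym lenA) q)
    BtoA : ∀ {x y} → x < NA → y < NA → at B x ≡ at B y → at A x ≡ at A y
    BtoA {x} {y} p q = reflects H x y (subst (x <_) (sym lenA) p) (subst (y <_) (sym lenA) q)

record Reduction (K₁ K₂ : Kind) (ν : ℕ) (w : Word) (a d c : ℕ) : Set where
  field
    w₀ : Word
    length-w₀ : length w₀ ≡ a + d + c
    overlap₀ : SamePattern (insertAt K₁ w₀ ν 0 a) (insertAt K₂ w₀ ν (a + d) c)
    reinserted : SamePattern w (insertAt K₂ w₀ ν (a + d) c)

Reduction-shorter : ∀ {K₁ K₂ ν' w a d c} (R : Reduction K₁ K₂ (suc ν') w a d c) → length (Reduction.w₀ R) < length w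
Reduction-shorter {K₁} {K₂} {ν'} {w} {a} {d} {c} R = begin-strict
  length w₀                               ≡⟨ length-w₀ ⟩
  a + d + c                               <⟨ +-monoʳ-< (a + d) (s≤s (≤-trans (m≤m+n c _) (m≤n+m _ ν'))) ⟩
  slotCount (a + d) c 0 (suc ν')          ≡⟨ length-insertAt K₂ w₀ (suc ν') (a + d) c 0 (trans length-w₀ (sym (+-identityʳ _))) ⟨
  length (insertAt K₂ w₀ (suc ν') (a + d) c) ≡⟨ length≡ reinserted ⟨
  length w                                ∎
  where
  open Reduction R
  open ≤-Reasoning

module GapPeel (K₁ K₂ : Kind) (ν : ℕ) (w : Word) (a d' c : ℕ) (L : length w ≡ a + (ν + ν + d') + c) where
  open Overlap K₁ K₂ ν w a (ν + ν + d') c L public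
  s' : ℕ
  s' = a + d'
  L' : length w ≡ slotCount s' c 0 ν
  L' = trans L (e a ν d' c)
    where
    e : ∀ a ν d' c → a + (ν + ν + d') + c ≡ a + d' + (ν + (c + (ν + 0)))
    e = solve-∀
  open Deletion K₂ w ν s' c L' public

  e-P : ∀ a ν d' k → ν + (a + (ν + (d' + k))) ≡ a + (ν + ν + d') + k
  e-P = solve-∀
  e-r3 : ∀ a ν j → ν + (a + (ν + j)) ≡ a + ν + ν + j
  e-r3 = solve-∀
  e-sB : ∀ a ν d' k → a + (ν + ν + d') + k ≡ a + ν + ν + (d' + k)
  e-sB = solve-∀
  e-as : ∀ a d' k → a + (d' + k) ≡ a + d' + k
  e-as = solve-∀

  module _ (H : SamePattern A B) where
    below-a : ∀ y → y < a → ∀ k → ν + y ≢ a + (ν + ν + d') + k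
    below-a y ya k eq = <⇒≢ (<-≤-trans (+-monoʳ-< ν ya) (≤-witness (ν + a) _ (ν + d' + k) (e a ν d' k))) eq
      where
      e : ∀ a ν d' k → ν + a + (ν + d' + k) ≡ a + (ν + ν + d') + k
      e = solve-∀

    beyond-a< : ∀ j → a + j < n → j < ν + ν + d' + c
    beyond-a< j p = +-cancelˡ-< a _ _ (subst (a + j <_) (e a ν d' c) p)
      where
      e : ∀ a ν d' c → a + d' + (ν + (c + (ν + 0))) ≡ a + (ν + ν + d' + c)
      e = solve-∀

    at-A-suf : ∀ j → j < ν + ν + d' + c → at A (ν + (a + (ν + j))) ≡ at w (a + j)
    at-A-suf j p = at-insertAt-suf K₁ w ν 0 a (ν + ν + d' + c) LA j p
    A-suf< : ∀ j → j < ν + ν + d' + c → ν + (a + (ν + j)) < NA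
    A-suf< j p = slot-bound (suf {0} {a} {ν + ν + d' + c} {ν} j p refl)

    -- Position sB + i, which holds the i-th inserted symbol in B and the letter w[s' + i] in A.
    anchor : ℕ → ℕ
    anchor i = ν + (a + (ν + (d' + i)))

    module _ (i : ℕ) (i<ν : i < ν) where
      d'+i< : d' + i < ν + ν + d' + c
      d'+i< = beyond-a< (d' + i) (subst (_< n) (sym (e-as a d' i)) (+-monoʳ-< (a + d') (≤-trans i<ν (m≤m+n ν _))))

      at-A-anchor : at A (anchor i) ≡ at w (s' + i)
      at-A-anchor = trans (at-A-suf (d' + i) d'+i<) (cong (at w) (e-as a d' i))

      anchor< : anchor i < NA
      anchor< = A-suf< (d' + i) d'+i<

      anchor-partners : ∀ {x} → x < NA → at w (s' + i) ≡ at A x → (x ≡ sB + i) ⊎ (x ≡ sB + (ν + (c + partner K₂ ν i)))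
      anchor-partners x< eq =
        block₁-partners K₂ w ν sB c 0 LB i i<ν (toNB x<) (trans (cong (at B) (sym (e-P a ν d' i))) (AtoB H anchor< x< (trans at-A-anchor eq)))

      no-partner-below-a : ∀ y → y < a → at w (s' + i) ≢ at w y
      no-partner-below-a y y<a eq with anchor-partners (slot-bound (mid {0} {a} {ν + ν + d' + c} {ν} y y<a refl))
                                          (trans eq (sym (at-insertAt-mid K₁ w ν 0 a (ν + ν + d' + c) LA y y<a)))
      ... | inj₁ e = below-a y y<a i e
      ... | inj₂ e = below-a y y<a _ e

      partner-beyond-a : ∀ j → a + j < n → at w (s' + i) ≡ at w (a + j) → (a + j ≡ s' + i) ⊎ (a + j ≡ s' + (ν + (c + partner K₂ ν i)))
      partner-beyond-a j a+j<n eq with anchor-partners (A-suf< j (beyond-a< j a+j<n)) (trans eq (sym (at-A-suf j (beyond-a< j a+j<n))))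
      ... | inj₁ e = inj₁ (trans (cong (a +_) (+-cancelˡ-at (a + ν + ν) j (d' + i) (e-r3 a ν j) (e-sB a ν d' i) e)) (e-as a d' i))
      ... | inj₂ e = inj₂ (trans (cong (a +_) (+-cancelˡ-at (a + ν + ν) j _ (e-r3 a ν j) (e-sB a ν d' _) e)) (e-as a d' _))

      linked : at w (s' + i) ≡ at w (s' + (ν + (c + partner K₂ ν i)))
      linked = trans (sym at-A-anchor) (trans (BtoA H anchor< (A-suf< k k<) eqB) (trans (at-A-suf k k<) (cong (at w) (e-as a d' _))))
        where
        k : ℕ
        k = d' + (ν + (c + partner K₂ ν i))
        k< : k < ν + ν + d' + c
        k< = <-witness k _ (ν ∸ suc (partner K₂ ν i)) (e2 (ν ∸ suc (partner K₂ ν i)) (m+[n∸m]≡n (partner< K₂ ν i i<ν)))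
          where
          e2 : ∀ r → suc (partner K₂ ν i) + r ≡ ν → k + suc r ≡ ν + ν + d' + c
          e2 r h = trans (e3 d' ν c (partner K₂ ν i) r) (cong (λ z → z + ν + d' + c) h)
            where
            e3 : ∀ d' ν c p r → d' + (ν + (c + p)) + suc r ≡ suc p + r + ν + d' + c
            e3 = solve-∀
        eqB : at B (anchor i) ≡ at B (ν + (a + (ν + k)))
        eqB = trans (cong (at B) (e-P a ν d' i)) (trans (block₁≡block₂ K₂ w ν sB c 0 LB i i<ν) (cong (at B) (sym (e-P a ν d' _))))

    blocksPaired : BlocksPaired
    blocksPaired i i<ν y y<n = to , from
      where
      to : at w (s' + i) ≡ at w y → (y ≡ s' + i) ⊎ (y ≡ s' + (ν + (c + partner K₂ ν i)))
      to eq with <⊎+ a y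
      ... | inj₁ y<a = ⊥-elim (no-partner-below-a i i<ν y y<a eq)
      ... | inj₂ (j , refl) = partner-beyond-a i i<ν j y<n eq
      from : (y ≡ s' + i) ⊎ (y ≡ s' + (ν + (c + partner K₂ ν i))) → at w (s' + i) ≡ at w y
      from (inj₁ refl) = refl
      from (inj₂ refl) = linked i i<ν

module Recovery (K₁ : Kind) (ν : ℕ) (w w₀ B : Word) (a f a₀ f₀ : ℕ)
  (LA : length w ≡ 0 + a + f) (LA₀ : length w₀ ≡ 0 + a₀ + f₀) (Ln : length w ≡ slotCount 0 a₀ f₀ ν)
  (AB : ∀ {z z'} → z < slotCount 0 a f ν → z' < slotCount 0 a f ν → (at (insertAt K₁ w ν 0 a) z ≡ at (insertAt K₁ w ν 0 a) z') → at B z ≡ at B z')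
  (BA : ∀ {z z'} → z < slotCount 0 a f ν → z' < slotCount 0 a f ν → at B z ≡ at B z' → (at (insertAt K₁ w ν 0 a) z ≡ at (insertAt K₁ w ν 0 a) z')) where
  A A₀ : Word
  A = insertAt K₁ w ν 0 a
  A₀ = insertAt K₁ w₀ ν 0 a₀

  record Correspondence (x : ℕ) (m0 : ℕ ⊎ ℕ) : Set where
    field
      z : ℕ
      z-slot : Slot 0 a f ν z
      same-meaning : meaning K₁ w z-slot ≡ m0
      B-shows : at B z ≡ at w x

  module _ (correspondence : ∀ {x} (c0 : Slot 0 a₀ f₀ ν x) → Correspondence x (meaning K₁ w₀ c0)) where
    recovery-pattern : ∀ x x' → x < slotCount 0 a₀ f₀ ν → x' < slotCount 0 a₀ f₀ ν → (at A₀ x ≡ at A₀ x') ⇔ (at w x ≡ at w x')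
    recovery-pattern x x' xp xp' = to , from
      where
      c0 = slot 0 a₀ f₀ ν x xp
      c0' = slot 0 a₀ f₀ ν x' xp'
      C = correspondence c0
      C' = correspondence c0'
      open Correspondence C
      open Correspondence C' renaming (z to z'; z-slot to z-slot′; same-meaning to same-meaning′; B-shows to B-shows′)
      E0 = insertAt-pattern K₁ w₀ ν 0 a₀ f₀ LA₀ c0 c0'
      E1 = insertAt-pattern K₁ w ν 0 a f LA z-slot z-slot′
      to : at A₀ x ≡ at A₀ x' → at w x ≡ at w x'
      to eq = trans (sym B-shows) (trans (AB (slot-bound z-slot) (slot-bound z-slot′) (proj₂ E1 (trans same-meaning (trans (proj₁ E0 eq) (sym same-meaning′))))) B-shows′)
      from : at w x ≡ at w x' → at A₀ x ≡ at A₀ x'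
      from eq = proj₂ E0 (trans (sym same-meaning) (trans (proj₁ E1 (BA (slot-bound z-slot) (slot-bound z-slot′) (trans B-shows (trans eq (sym B-shows′))))) same-meaning′))

    recovered : SamePattern A₀ w
    recovered = record { length≡ = trans (length-insertAt K₁ w₀ ν 0 a₀ f₀ LA₀) (sym Ln)
                ; preserves = λ i j p q → proj₁ (recovery-pattern i j (lA p) (lA q))
                ; reflects = λ i j p q → proj₂ (recovery-pattern i j (lA p) (lA q)) }
      where
      lA : ∀ {i} → i < length A₀ → i < slotCount 0 a₀ f₀ ν
      lA {i} = subst (i <_) (length-insertAt K₁ w₀ ν 0 a₀ f₀ LA₀)

module GapReduction (K₁ K₂ : Kind) (ν : ℕ) (w : Word) (a d' c : ℕ) (L : length w ≡ a + (ν + ν + d') + c)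
  (H : SamePattern (insertAt K₁ w ν 0 a) (insertAt K₂ w ν (a + (ν + ν + d')) c)) where
  open GapPeel K₁ K₂ ν w a d' c L

  LA₀ : length w₀ ≡ 0 + a + (d' + c)
  LA₀ = trans L₀ (e a d' c)
    where
    e : ∀ a d' c → a + d' + c + 0 ≡ a + (d' + c)
    e = solve-∀
  Ln : length w ≡ slotCount 0 a (d' + c) ν
  Ln = trans L (e a ν d' c)
    where
    e : ∀ a ν d' c → a + (ν + ν + d') + c ≡ ν + (a + (ν + (d' + c)))
    e = solve-∀

  open Recovery K₁ ν w w₀ B a (ν + ν + d' + c) a (d' + c) LA LA₀ Ln (AtoB H) (BtoA H) using (Correspondence; recovered)

  correspondence : ∀ {x} (c0 : Slot 0 a (d' + c) ν x) → Correspondence x (meaning K₁ w₀ c0)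
  correspondence (blk₁ i p refl) = record
    { z = i
    ; z-slot = blk₁ i p refl
    ; same-meaning = refl
    ; B-shows = at-insertAt-pre K₂ w ν sB c 0 LB i ib }
    where
    ib : i < sB
    ib = ≤-trans p (≤-witness ν sB (a + ν + d') (e a ν d'))
      where
      e : ∀ a ν d' → ν + (a + ν + d') ≡ a + (ν + ν + d')
      e = solve-∀
  correspondence (mid j p refl) = record
    { z = ν + j
    ; z-slot = mid j p refl
    ; same-meaning = cong inj₁ (sym (at-deleted-pre j (≤-trans p (m≤m+n a d'))))
    ; B-shows = at-insertAt-pre K₂ w ν sB c 0 LB (ν + j) jb }
    where
    jb : ν + j < sB
    jb = <-≤-trans (+-monoʳ-< ν p) (≤-witness (ν + a) sB (ν + d') (e a ν d'))
      where
      e : ∀ a ν d' → ν + a + (ν + d') ≡ a + (ν + ν + d')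
      e = solve-∀
  correspondence (blk₂ i p refl) = record
    { z = ν + (a + i)
    ; z-slot = blk₂ i p refl
    ; same-meaning = refl
    ; B-shows = at-insertAt-pre K₂ w ν sB c 0 LB _ ib }
    where
    ib : ν + (a + i) < sB
    ib = <-≤-trans (+-monoʳ-< ν (+-monoʳ-< a p)) (≤-witness (ν + (a + ν)) sB d' (e a ν d'))
      where
      e : ∀ a ν d' → ν + (a + ν) + d' ≡ a + (ν + ν + d')
      e = solve-∀
  correspondence {x} (suf j p refl) with <⊎+ d' j
  ... | inj₁ jd = record
    { z = x
    ; z-slot = suf j jb refl
    ; same-meaning = cong inj₁ (sym (at-deleted-pre (a + j) (+-monoʳ-< a jd)))
    ; B-shows = at-insertAt-pre K₂ w ν sB c 0 LB x xb }
    where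
    jb : j < ν + ν + d' + c
    jb = ≤-trans jd (≤-witness d' _ (ν + ν + c) (e d' ν c))
      where
      e : ∀ d' ν c → d' + (ν + ν + c) ≡ ν + ν + d' + c
      e = solve-∀
    xb : x < sB
    xb = <-≤-trans (+-monoʳ-< ν (+-monoʳ-< a (+-monoʳ-< ν jd))) (≤-witness _ sB 0 (e a ν d'))
      where
      e : ∀ a ν d' → ν + (a + (ν + d')) + 0 ≡ a + (ν + ν + d')
      e = solve-∀
  ... | inj₂ (j' , refl) = record
    { z = ν + (a + (ν + (d' + (ν + j'))))
    ; z-slot = suf (d' + (ν + j')) kb refl
    ; same-meaning = cong inj₁ (sym (trans (cong (at w₀) (e-as a d' j')) (trans (at-deleted-mid j' j'c) (cong (at w) (sym (e-as a d' _))))))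
    ; B-shows = trans (cong (at B) (e1 a ν d' j')) (trans (at-insertAt-mid K₂ w ν sB c 0 LB j' j'c) (cong (at w) (e2 a ν d' j'))) }
    where
    j'c : j' < c
    j'c = +-cancelˡ-< d' _ _ p
    kb : d' + (ν + j') < ν + ν + d' + c
    kb = <-≤-trans (+-monoʳ-< d' (+-monoʳ-< ν j'c)) (≤-witness _ _ ν (e d' ν c))
      where
      e : ∀ d' ν c → d' + (ν + c) + ν ≡ ν + ν + d' + c
      e = solve-∀
    e1 : ∀ a ν d' j' → ν + (a + (ν + (d' + (ν + j')))) ≡ a + (ν + ν + d') + (ν + j')
    e1 = solve-∀
    e2 : ∀ a ν d' j' → a + (ν + ν + d') + j' ≡ ν + (a + (ν + (d' + j')))
    e2 = solve-∀

  gapRecovery : SamePattern (insertAt K₁ w₀ ν 0 a) w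
  gapRecovery = recovered correspondence

  gapReinsertion : SamePattern w (insertAt K₂ w₀ ν s' c)
  gapReinsertion = reinsertion (blocksPaired H)

  reduction : Reduction K₁ K₂ ν w a d' c
  reduction = record
    { w₀ = w₀ ; length-w₀ = trans L₀ (+-identityʳ _)
    ; overlap₀ = SamePattern-trans gapRecovery gapReinsertion ; reinserted = gapReinsertion }

module EndReduction (K₁ K₂ : Kind) (ν : ℕ) (w : Word) (a' c' : ℕ) (L : length w ≡ ν + a' + 0 + (ν + c'))
  (H : SamePattern (insertAt K₁ w ν 0 (ν + a')) (insertAt K₂ w ν (ν + a' + 0) (ν + c'))) where
  open Overlap K₁ K₂ ν w (ν + a') 0 (ν + c') L
  L' : length w ≡ slotCount a' c' 0 ν
  L' = trans L (e a' ν c')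
    where
    e : ∀ a' ν c' → ν + a' + 0 + (ν + c') ≡ a' + (ν + (c' + (ν + 0)))
    e = solve-∀
  open Deletion K₂ w ν a' c' L'

  fB : ℕ
  fB = 0 + (ν + c')

  at-A-mid : ∀ j → j < ν + a' → at A (ν + j) ≡ at w j
  at-A-mid j p = at-insertAt-mid K₁ w ν 0 (ν + a') fB LA j p
  A-mid< : ∀ j → j < ν + a' → ν + j < NA
  A-mid< j p = slot-bound (mid {0} {ν + a'} {fB} {ν} j p refl)
  at-A-suf : ∀ j → j < fB → at A (ν + (ν + a' + (ν + j))) ≡ at w (ν + a' + j)
  at-A-suf j p = at-insertAt-suf K₁ w ν 0 (ν + a') fB LA j p
  A-suf< : ∀ j → j < fB → ν + (ν + a' + (ν + j)) < NA
  A-suf< j p = slot-bound (suf {0} {ν + a'} {fB} {ν} j p refl)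

  e-P : ∀ ν a' i → ν + (a' + i) ≡ ν + a' + 0 + i
  e-P = solve-∀
  e4 : ∀ ν a' c' p → ν + a' + (c' + p) ≡ a' + (ν + (c' + p))
  e4 = solve-∀

  -- Position sB + i, which holds the i-th inserted symbol in B and the letter w[a' + i] in A.
  anchor : ℕ → ℕ
  anchor i = ν + (a' + i)

  module _ (i : ℕ) (i<ν : i < ν) where
    a'+i< : a' + i < ν + a'
    a'+i< = subst (_< ν + a') (+-comm i a') (+-monoˡ-< a' i<ν)

    anchor< : anchor i < NA
    anchor< = A-mid< (a' + i) a'+i<

    anchor-partners : ∀ {x} → x < NA → at w (a' + i) ≡ at A x → (x ≡ sB + i) ⊎ (x ≡ sB + (ν + (ν + c' + partner K₂ ν i)))
    anchor-partners x< eq =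
      block₁-partners K₂ w ν sB (ν + c') 0 LB i i<ν (toNB x<) (trans (cong (at B) (sym (e-P ν a' i))) (AtoB H anchor< x< (trans (at-A-mid _ a'+i<) eq)))

    partner-below : ∀ y → y < ν + a' → at w (a' + i) ≡ at w y → (y ≡ a' + i) ⊎ (y ≡ a' + (ν + (c' + partner K₂ ν i)))
    partner-below y y< eq with anchor-partners (A-mid< y y<) (trans eq (sym (at-A-mid y y<)))
    ... | inj₁ e = inj₁ (+-cancelˡ-at ν y (a' + i) refl (sym (e-P ν a' i)) e)
    ... | inj₂ e = ⊥-elim (<⇒≢ (<-≤-trans (+-monoʳ-< ν y<) (≤-witness _ _ (ν + c' + partner K₂ ν i) (e2 ν a' c' (partner K₂ ν i)))) e)
      where
      e2 : ∀ ν a' c' p → ν + (ν + a') + (ν + c' + p) ≡ ν + a' + 0 + (ν + (ν + c' + p))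
      e2 = solve-∀

    partner-beyond : ∀ j → ν + a' + j < n → at w (a' + i) ≡ at w (ν + a' + j) →
      (ν + a' + j ≡ a' + i) ⊎ (ν + a' + j ≡ a' + (ν + (c' + partner K₂ ν i)))
    partner-beyond j j< eq with anchor-partners (A-suf< j j<fB) (trans eq (sym (at-A-suf j j<fB)))
      where
      j<fB : j < fB
      j<fB = +-cancelˡ-< (ν + a') _ _ (subst (ν + a' + j <_) (e1 ν a' c') j<)
        where
        e1 : ∀ ν a' c' → a' + (ν + (c' + (ν + 0))) ≡ ν + a' + (ν + c')
        e1 = solve-∀
    ... | inj₁ e = ⊥-elim (<⇒≢ (<-≤-trans (+-monoʳ-< (ν + a' + 0) i<ν) (≤-witness _ _ (ν + j) (e2 ν a' j))) (sym e))
      where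
      e2 : ∀ ν a' j → ν + a' + 0 + ν + (ν + j) ≡ ν + (ν + a' + (ν + j))
      e2 = solve-∀
    ... | inj₂ e = inj₂ (trans (cong (ν + a' +_) j≡) (e4 ν a' c' (partner K₂ ν i)))
      where
      e2 : ∀ ν a' j → ν + (ν + a' + (ν + j)) ≡ ν + ν + ν + a' + j
      e2 = solve-∀
      e3 : ∀ ν a' c' p → ν + a' + 0 + (ν + (ν + c' + p)) ≡ ν + ν + ν + a' + (c' + p)
      e3 = solve-∀
      j≡ : j ≡ c' + partner K₂ ν i
      j≡ = +-cancelˡ-at (ν + ν + ν + a') j _ (e2 ν a' j) (e3 ν a' c' (partner K₂ ν i)) e

    linked : at w (a' + i) ≡ at w (a' + (ν + (c' + partner K₂ ν i)))
    linked = trans (sym (at-A-mid _ a'+i<)) (trans eqA (trans (at-A-suf k k<) (cong (at w) (e4 ν a' c' (partner K₂ ν i)))))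
      where
      k : ℕ
      k = c' + partner K₂ ν i
      k< : k < fB
      k< = subst (k <_) (+-comm c' ν) (+-monoʳ-< c' (partner< K₂ ν i i<ν))
      e5 : ∀ ν a' c' p → ν + (ν + a' + (ν + (c' + p))) ≡ ν + a' + 0 + (ν + (ν + c' + p))
      e5 = solve-∀
      eqA : at A (anchor i) ≡ at A (ν + (ν + a' + (ν + k)))
      eqA = BtoA H anchor< (A-suf< k k<) (trans (cong (at B) (e-P ν a' i)) (trans (block₁≡block₂ K₂ w ν sB (ν + c') 0 LB i i<ν) (cong (at B) (sym (e5 ν a' c' (partner K₂ ν i))))))

  blocksPaired : BlocksPaired
  blocksPaired i i<ν y y<n = to , from
    where
    to : at w (a' + i) ≡ at w y → (y ≡ a' + i) ⊎ (y ≡ a' + (ν + (c' + partner K₂ ν i)))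
    to eq with <⊎+ (ν + a') y
    ... | inj₁ y< = partner-below i i<ν y y< eq
    ... | inj₂ (j , refl) = partner-beyond i i<ν j y<n eq
    from : (y ≡ a' + i) ⊎ (y ≡ a' + (ν + (c' + partner K₂ ν i))) → at w (a' + i) ≡ at w y
    from (inj₁ refl) = refl
    from (inj₂ refl) = linked i i<ν

  LA₀ : length w₀ ≡ 0 + a' + c'
  LA₀ = trans L₀ (+-identityʳ _)
  Ln : length w ≡ slotCount 0 a' c' ν
  Ln = trans L (e a' ν c')
    where
    e : ∀ a' ν c' → ν + a' + 0 + (ν + c') ≡ ν + (a' + (ν + c'))
    e = solve-∀

  open Recovery K₁ ν w w₀ B (ν + a') fB a' c' LA LA₀ Ln (AtoB H) (BtoA H) using (Correspondence; recovered)

  correspondence : ∀ {x} (c0 : Slot 0 a' c' ν x) → Correspondence x (meaning K₁ w₀ c0)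
  correspondence (blk₁ i p refl) = record
    { z = i
    ; z-slot = blk₁ i p refl
    ; same-meaning = refl
    ; B-shows = at-insertAt-pre K₂ w ν sB (ν + c') 0 LB i ib }
    where
    ib : i < sB
    ib = ≤-trans p (≤-witness ν sB a' (e a' ν))
      where
      e : ∀ a' ν → ν + a' ≡ ν + a' + 0
      e = solve-∀
  correspondence (mid j p refl) = record
    { z = ν + j
    ; z-slot = mid j (≤-trans p (m≤n+m a' ν)) refl
    ; same-meaning = cong inj₁ (sym (at-deleted-pre j p))
    ; B-shows = at-insertAt-pre K₂ w ν sB (ν + c') 0 LB (ν + j) jb }
    where
    jb : ν + j < sB
    jb = subst (ν + j <_) (sym (+-identityʳ _)) (+-monoʳ-< ν p)
  correspondence (blk₂ i p refl) = record
    { z = ν + (ν + a' + i)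
    ; z-slot = blk₂ i p refl
    ; same-meaning = refl
    ; B-shows = trans (cong (at B) (e1 ν a' i)) (trans (at-insertAt-mid K₂ w ν sB (ν + c') 0 LB i (≤-trans p (m≤m+n ν c'))) (cong (at w) (e2 ν a' i))) }
    where
    e1 : ∀ ν a' i → ν + (ν + a' + i) ≡ ν + a' + 0 + (ν + i)
    e1 = solve-∀
    e2 : ∀ ν a' i → ν + a' + 0 + i ≡ ν + (a' + i)
    e2 = solve-∀
  correspondence (suf j p refl) = record
    { z = ν + (ν + a' + (ν + j))
    ; z-slot = suf j jb refl
    ; same-meaning = cong inj₁ (sym (trans (at-deleted-mid j p) (cong (at w) (e0 ν a' j))))
    ; B-shows = trans (cong (at B) (e1 ν a' j)) (trans (at-insertAt-mid K₂ w ν sB (ν + c') 0 LB (ν + j) (+-monoʳ-< ν p)) (cong (at w) (e2 ν a' j))) }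
    where
    jb : j < fB
    jb = ≤-trans p (m≤n+m c' ν)
    e0 : ∀ ν a' j → a' + (ν + j) ≡ 0 + (ν + a') + j
    e0 = solve-∀
    e1 : ∀ ν a' j → ν + (ν + a' + (ν + j)) ≡ ν + a' + 0 + (ν + (ν + j))
    e1 = solve-∀
    e2 : ∀ ν a' j → ν + a' + 0 + (ν + j) ≡ ν + (a' + (ν + j))
    e2 = solve-∀

  endReinsertion : SamePattern w (insertAt K₂ w₀ ν a' c')
  endReinsertion = reinsertion blocksPaired

  reduction : Reduction K₁ K₂ ν w a' 0 c'
  reduction = record
    { w₀ = w₀ ; length-w₀ = trans L₀ (e a' c')
    ; overlap₀ = shift (SamePattern-trans (recovered correspondence) endReinsertion) ; reinserted = shift endReinsertion }
    where
    shift : ∀ {x} → SamePattern x (insertAt K₂ w₀ ν a' c') → SamePattern x (insertAt K₂ w₀ ν (a' + 0) c')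
    shift = subst (λ t → SamePattern _ (insertAt K₂ w₀ ν t c')) (sym (+-identityʳ a'))
    e : ∀ a' c' → a' + c' + 0 ≡ a' + 0 + c'
    e = solve-∀

module Clashes (K₁ K₂ : Kind) (ν : ℕ) (w : Word) (a d c : ℕ) (L : length w ≡ a + d + c)
  (H : SamePattern (insertAt K₁ w ν 0 a) (insertAt K₂ w ν (a + d) c)) where
  open Overlap K₁ K₂ ν w a d c L

  A-pair : ∀ i → i < ν → at A (partner K₁ ν i) ≡ at A (ν + (a + i))
  A-pair i p = trans (block₁≡block₂ K₁ w ν 0 a (d + c) LA (partner K₁ ν i) (partner< K₁ ν i p)) (cong (λ z → at A (ν + (a + z))) (partner-involutive K₁ ν i p))
  A-blk₁< : ∀ i → i < ν → i < NA
  A-blk₁< i p = slot-bound (blk₁ {0} {a} {d + c} {ν} i p refl)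
  A-blk₂< : ∀ i → i < ν → ν + (a + i) < NA
  A-blk₂< i p = slot-bound (blk₂ {0} {a} {d + c} {ν} i p refl)
  B-pair : ∀ i → i < ν → at B (ν + (a + i)) ≡ at B (partner K₁ ν i)
  B-pair i p = sym (AtoB H (A-blk₁< _ (partner< K₁ ν i p)) (A-blk₂< i p) (A-pair i p))

  ν≤sB+ : ∀ k → ν ≤ sB + (ν + k)
  ν≤sB+ k = ≤-trans (m≤m+n ν k) (m≤n+m (ν + k) sB)

  0≢sB+ : 1 ≤ a → ∀ k → 0 ≢ sB + k
  0≢sB+ 1≤a k = <⇒≢ (≤-trans 1≤a (≤-trans (m≤m+n a d) (m≤m+n sB k)))

  blk₁-not-blk₁ : ∀ i i' → i < ν → i' < ν → ν + (a + i) ≡ sB + i' → ⊥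
  blk₁-not-blk₁ i i' p p' eq with block₁-partners K₂ w ν sB c 0 LB i' p' (toNB (A-blk₁< _ (partner< K₁ ν i p))) (trans (cong (at B) (sym eq)) (B-pair i p))
  ... | inj₁ e = <⇒≢ (<-≤-trans (partner< K₁ ν i p) (≤-trans (m≤m+n ν (a + i)) (≤-reflexive eq))) e
  ... | inj₂ e = <⇒≢ (<-≤-trans (partner< K₁ ν i p) (ν≤sB+ _)) e

  blk₁-not-blk₂ : ∀ i i' → i < ν → i' < ν → ν ≤ a → ν + (a + i) ≡ sB + (ν + (c + i')) → ⊥
  blk₁-not-blk₂ i i' p p' νa eq with block₂-partners K₂ w ν sB c 0 LB i' p' (toNB (A-blk₁< _ (partner< K₁ ν i p))) (trans (cong (at B) (sym eq)) (B-pair i p))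
  ... | inj₁ e = <⇒≢ (<-≤-trans (partner< K₁ ν i p) (ν≤sB+ _)) e
  ... | inj₂ e = <⇒≢ (<-≤-trans (partner< K₁ ν i p) (≤-trans νa (≤-trans (m≤m+n a d) (m≤m+n sB _)))) e

  first-not-blk₂ : ∀ i' → 1 ≤ a → i' < ν → ν + (a + partner K₁ ν 0) ≡ sB + (ν + (c + i')) → ⊥
  first-not-blk₂ i' 1≤a p' eq with block₂-partners K₂ w ν sB c 0 LB i' p' (toNB (A-blk₁< 0 ν1)) e0
    where
    ν1 : 0 < ν
    ν1 = ≤-trans (s≤s z≤n) p'
    e0 : at B (sB + (ν + (c + i'))) ≡ at B 0
    e0 = trans (cong (at B) (sym eq)) (trans (B-pair (partner K₁ ν 0) (partner< K₁ ν 0 ν1)) (cong (at B) (partner-involutive K₁ ν 0 ν1)))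
  ... | inj₁ e = 0≢sB+ 1≤a _ e
  ... | inj₂ e = 0≢sB+ 1≤a _ e

module Terminal (K₁ K₂ : Kind) (ν : ℕ) (w : Word) (a c : ℕ) (L : length w ≡ a + 0 + c)
  (H : SamePattern (insertAt K₁ w ν 0 a) (insertAt K₂ w ν (a + 0) c)) where
  open Overlap K₁ K₂ ν w a 0 c L
  open Clashes K₁ K₂ ν w a 0 c L H

  -- Position a opens the first inserted block of B and lies in that of A, so it has the same partner in both.
  block₁-edge : a < ν → partner K₁ ν a ≡ c + partner K₂ ν 0
  block₁-edge p with block₁-partners K₂ w ν sB c 0 LB 0 ν1 (toNB (A-blk₂< _ (partner< K₁ ν a p))) eB
    where
    ν1 : 0 < ν
    ν1 = ≤-trans (s≤s z≤n) p
    eA : at A a ≡ at A (ν + (a + partner K₁ ν a))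
    eA = block₁≡block₂ K₁ w ν 0 a (0 + c) LA a p
    eB : at B (sB + 0) ≡ at B (ν + (a + partner K₁ ν a))
    eB = trans (cong (at B) (e0 a)) (AtoB H (A-blk₁< a p) (A-blk₂< _ (partner< K₁ ν a p)) eA)
      where
      e0 : ∀ a → a + 0 + 0 ≡ a
      e0 = solve-∀
  ... | inj₁ e = ⊥-elim (<⇒≢ (<-witness (a + 0 + 0) _ (partner K₁ ν a + (ν ∸ 1)) (e1 a (partner K₁ ν a) (ν ∸ 1) ν (m+[n∸m]≡n (≤-trans (s≤s z≤n) p)))) (sym e))
    where
    e1 : ∀ a x r ν → 1 + r ≡ ν → a + 0 + 0 + suc (x + r) ≡ ν + (a + x)
    e1 a x r ν h = trans (e2 a x r) (cong (λ z → z + (a + x)) h)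
      where
      e2 : ∀ a x r → a + 0 + 0 + suc (x + r) ≡ 1 + r + (a + x)
      e2 = solve-∀
  ... | inj₂ e = +-cancelˡ-at (a + ν) _ _ (e1 ν a (partner K₁ ν a)) (e2 a ν c (partner K₂ ν 0)) e
    where
    e1 : ∀ ν a x → ν + (a + x) ≡ a + ν + x
    e1 = solve-∀
    e2 : ∀ a ν c y → a + 0 + (ν + (c + y)) ≡ a + ν + (c + y)
    e2 = solve-∀

module TerminalRepeat (ν : ℕ) (w : Word) (a c : ℕ) (L : length w ≡ a + 0 + c)
  (H : SamePattern (insertAt rep w ν 0 a) (insertAt rep w ν (a + 0) c)) (aν : a < ν) (ca : c ≡ a) where
  open Overlap rep rep ν w a 0 c L
  open Clashes rep rep ν w a 0 c L H

  n : ℕ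
  n = a + 0 + c
  B-pre< : ∀ y → y < sB → y < NA
  B-pre< y p = toNA (slot-bound (pre {sB} {c} {0} {ν} y p refl))
  B-mid< : ∀ y → y < c → sB + (ν + y) < NA
  B-mid< y p = toNA (slot-bound (mid {sB} {c} {0} {ν} y p refl))
  ja : ∀ {j} → j < a → j < sB
  ja {j} p = subst (j <_) (sym (+-identityʳ a)) p
  jν : ∀ {j} → j < a → j < ν
  jν p = <-trans p aν

  partners-below-sB : ∀ j y → j < a → y < sB → (at w j ≡ at w y) ⇔ ((y ≡ j) ⊎ (y ≡ a + j))
  partners-below-sB j y jp ya = to , from
    where
    to : at w j ≡ at w y → (y ≡ j) ⊎ (y ≡ a + j)
    to eq with block₁-partners rep w ν 0 a (0 + c) LA j (jν jp) (B-pre< y ya)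
                 (BtoA H (B-pre< j (ja jp)) (B-pre< y ya) (trans (at-insertAt-pre rep w ν sB c 0 LB j (ja jp)) (trans eq (sym (at-insertAt-pre rep w ν sB c 0 LB y ya)))))
    ... | inj₁ e = inj₁ e
    ... | inj₂ e = ⊥-elim (<⇒≢ (<-≤-trans ya (≤-witness sB _ (ν + j) (e1 a ν j))) e)
      where
      e1 : ∀ a ν j → a + 0 + (ν + j) ≡ ν + (a + j)
      e1 = solve-∀
    from : (y ≡ j) ⊎ (y ≡ a + j) → at w j ≡ at w y
    from (inj₁ refl) = refl
    from (inj₂ refl) = ⊥-elim (<⇒≱ ya (≤-witness sB _ j (e1 a j)))
      where
      e1 : ∀ a j → a + 0 + j ≡ a + j
      e1 = solve-∀
  partners-beyond-sB : ∀ j y' → j < a → sB + y' < n → (at w j ≡ at w (sB + y')) ⇔ ((sB + y' ≡ j) ⊎ (sB + y' ≡ a + j))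
  partners-beyond-sB j y' jp yn = to , from
    where
    y'c : y' < c
    y'c = +-cancelˡ-< sB _ _ yn
    P = sB + (ν + y')
    eP : at B P ≡ at w (sB + y')
    eP = at-insertAt-mid rep w ν sB c 0 LB y' y'c
    to : at w j ≡ at w (sB + y') → (sB + y' ≡ j) ⊎ (sB + y' ≡ a + j)
    to eq with block₁-partners rep w ν 0 a (0 + c) LA j (jν jp) (B-mid< y' y'c)
                 (BtoA H (B-pre< j (ja jp)) (B-mid< y' y'c) (trans (at-insertAt-pre rep w ν sB c 0 LB j (ja jp)) (trans eq (sym eP))))
    ... | inj₁ e = ⊥-elim (<⇒≢ (<-≤-trans (jν jp) (≤-trans (m≤m+n ν y') (m≤n+m _ sB))) (sym e))
    ... | inj₂ e = inj₂ (trans (cong (_+ y') (+-identityʳ a)) (cong (a +_) (+-cancelˡ-at (a + ν) y' j (e1 a ν y') (e2 a ν j) e)))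
      where
      e1 : ∀ a ν y' → a + 0 + (ν + y') ≡ a + ν + y'
      e1 = solve-∀
      e2 : ∀ a ν j → 0 + (ν + (a + j)) ≡ a + ν + j
      e2 = solve-∀
    from : (sB + y' ≡ j) ⊎ (sB + y' ≡ a + j) → at w j ≡ at w (sB + y')
    from (inj₁ e) = ⊥-elim (<⇒≱ jp (≤-trans (m≤m+n a 0) (≤-trans (m≤m+n sB y') (≤-reflexive e))))
    from (inj₂ e) = trans (sym (at-insertAt-pre rep w ν sB c 0 LB j (ja jp))) (trans eB eP)
      where
      yj : y' ≡ j
      yj = +-cancelˡ-≡ a y' j (trans (sym (cong (_+ y') (+-identityʳ a))) e)
      eA : at A j ≡ at A (ν + (a + j))
      eA = block₁≡block₂ rep w ν 0 a (0 + c) LA j (jν jp)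
      eB : at B j ≡ at B P
      eB = trans (AtoB H (A-blk₁< j (jν jp)) (A-blk₂< j (jν jp)) eA) (cong (at B) (trans (e1 a ν j) (cong (λ z → sB + (ν + z)) (sym yj))))
        where
        e1 : ∀ a ν j → ν + (a + j) ≡ a + 0 + (ν + j)
        e1 = solve-∀

  partners-of-first-half : ∀ j y → j < a → y < n → (at w j ≡ at w y) ⇔ ((y ≡ j) ⊎ (y ≡ a + j))
  partners-of-first-half j y jp yn with <⊎+ sB y
  ... | inj₁ ya = partners-below-sB j y jp ya
  ... | inj₂ (y' , refl) = partners-beyond-sB j y' jp yn

  -- x mod a, for x < a + a.
  residue : ℕ → ℕ
  residue x with <⊎+ a x
  ... | inj₁ _ = x
  ... | inj₂ (y , _) = y

  residue-< : ∀ x → x < a → residue x ≡ x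
  residue-< x p with <⊎+ a x
  ... | inj₁ _ = refl
  ... | inj₂ (y , refl) = ⊥-elim (<⇒≱ p (m≤m+n a y))

  residue-+ : ∀ j → residue (a + j) ≡ j
  residue-+ j with <⊎+ a (a + j)
  ... | inj₁ p = ⊥-elim (<⇒≱ p (m≤m+n a j))
  ... | inj₂ (y , e) = +-cancelˡ-≡ a y j (sym e)

  n≡ : n ≡ a + a
  n≡ = trans (cong₂ _+_ (+-identityʳ a) ca) refl

  first-half-pattern′ : ∀ x y → x < a → y < n → (y < a) ⊎ (Σ ℕ λ j → y ≡ a + j) → (at w x ≡ at w y) ⇔ (residue x ≡ residue y)
  first-half-pattern′ x y xa yn (inj₁ ya) = (λ eq → case (proj₁ (partners-of-first-half x y xa yn) eq))
    , (λ e → proj₂ (partners-of-first-half x y xa yn) (inj₁ (trans (sym (residue-< y ya)) (trans (sym e) (residue-< x xa)))))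
    where
    case : (y ≡ x) ⊎ (y ≡ a + x) → residue x ≡ residue y
    case (inj₁ e) = cong residue (sym e)
    case (inj₂ e) = ⊥-elim (<⇒≱ ya (≤-trans (m≤m+n a x) (≤-reflexive (sym e))))
  first-half-pattern′ x .(a + j) xa yn (inj₂ (j , refl)) = (λ eq → case (proj₁ (partners-of-first-half x (a + j) xa yn) eq))
    , (λ e → proj₂ (partners-of-first-half x (a + j) xa yn) (inj₂ (cong (a +_) (trans (sym (residue-+ j)) (trans (sym e) (residue-< x xa))))))
    where
    case : (a + j ≡ x) ⊎ (a + j ≡ a + x) → residue x ≡ residue (a + j)
    case (inj₁ e) = ⊥-elim (<⇒≱ xa (≤-trans (m≤m+n a j) (≤-reflexive e)))
    case (inj₂ e) = trans (residue-< x xa) (trans (sym (+-cancelˡ-≡ a j x e)) (sym (residue-+ j)))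

  first-half-pattern : ∀ x y → x < a → y < n → (at w x ≡ at w y) ⇔ (residue x ≡ residue y)
  first-half-pattern x y xa yn = first-half-pattern′ x y xa yn (<⊎+ a y)

  residue-pattern′ : ∀ x y → x < n → y < n → (x < a) ⊎ (Σ ℕ λ j → x ≡ a + j) → (y < a) ⊎ (Σ ℕ λ j → y ≡ a + j) → (at w x ≡ at w y) ⇔ (residue x ≡ residue y)
  residue-pattern′ x y xn yn (inj₁ xa) _ = first-half-pattern x y xa yn
  residue-pattern′ .(a + j) y xn yn (inj₂ (j , refl)) (inj₁ ya) = (λ eq → sym (proj₁ (first-half-pattern y (a + j) ya xn) (sym eq)))
    , (λ e → sym (proj₂ (first-half-pattern y (a + j) ya xn) (sym e)))
  residue-pattern′ .(a + j) .(a + j') xn yn (inj₂ (j , refl)) (inj₂ (j' , refl)) =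
      (λ eq → trans (residue-+ j) (trans (sym (residue-< j jA)) (proj₁ (first-half-pattern j (a + j') jA yn) (trans lnk eq))))
    , (λ e → trans (sym lnk) (proj₂ (first-half-pattern j (a + j') jA yn) (trans (residue-< j jA) (trans (sym (residue-+ j)) e))))
    where
    jA : j < a
    jA = +-cancelˡ-< a j a (subst (a + j <_) n≡ xn)
    lnk : at w j ≡ at w (a + j)
    lnk = proj₂ (partners-of-first-half j (a + j) jA xn) (inj₂ refl)

  residue-pattern : ∀ x y → x < n → y < n → (at w x ≡ at w y) ⇔ (residue x ≡ residue y)
  residue-pattern x y xn yn = residue-pattern′ x y xn yn (<⊎+ a x) (<⊎+ a y)

  at-s₀-< : ∀ j → j < a → at (s₀ a) j ≡ suc j
  at-s₀-< j p = trans (at-++ˡ (applyUpTo suc a) _ j (subst (j <_) (sym (length-applyUpTo suc a)) p)) (at-applyUpTo suc a j p)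
  at-s₀-+ : ∀ j → j < a → at (s₀ a) (a + j) ≡ suc j
  at-s₀-+ j p = trans (at-++ʳ′ (applyUpTo suc a) (applyUpTo suc a) a j (length-applyUpTo suc a)) (at-applyUpTo suc a j p)
  at-s₀′ : ∀ x → x < n → (x < a) ⊎ (Σ ℕ λ j → x ≡ a + j) → at (s₀ a) x ≡ suc (residue x)
  at-s₀′ x xn (inj₁ xa) = trans (at-s₀-< x xa) (cong suc (sym (residue-< x xa)))
  at-s₀′ .(a + j) xn (inj₂ (j , refl)) = trans (at-s₀-+ j (+-cancelˡ-< a j a (subst (a + j <_) n≡ xn))) (cong suc (sym (residue-+ j)))
  at-s₀ : ∀ x → x < n → at (s₀ a) x ≡ suc (residue x)
  at-s₀ x xn = at-s₀′ x xn (<⊎+ a x)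

  repeat-terminal : SamePattern w (s₀ a)
  repeat-terminal = record { length≡ = trans L (trans n≡ (sym ls₀))
    ; preserves = λ x y p q e → trans (at-s₀ x (lw p)) (trans (cong suc (proj₁ (residue-pattern x y (lw p) (lw q)) e)) (sym (at-s₀ y (lw q))))
    ; reflects = λ x y p q e → proj₂ (residue-pattern x y (lw p) (lw q)) (suc-injective (trans (sym (at-s₀ x (lw p))) (trans e (at-s₀ y (lw q))))) }
    where
    ls₀ : length (s₀ a) ≡ a + a
    ls₀ = trans (length-++ (applyUpTo suc a)) (cong₂ _+_ (length-applyUpTo suc a) (length-applyUpTo suc a))
    lw : ∀ {x} → x < length w → x < n
    lw {x} = subst (x <_) L

m+n≤n⇒m≡0 : ∀ c k → c + k ≤ k → c ≡ 0
m+n≤n⇒m≡0 c k p = n≤0⇒n≡0 (+-cancelʳ-≤ k c 0 p)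

length0⇒SamePattern[] : ∀ (w : Word) → length w ≡ 0 → SamePattern w []
length0⇒SamePattern[] [] _ = SamePattern-refl

ret-rep-wide-impossible : ∀ ν₁ w c (L : length w ≡ 0 + 0 + c) →
  SamePattern (insertAt ret w (suc (suc ν₁)) 0 0) (insertAt rep w (suc (suc ν₁)) (0 + 0) c) → c ≡ suc ν₁ → ⊥
ret-rep-wide-impossible ν₁ w c L H refl with block₁-partners ret w ν 0 0 (0 + c) LA ν₀ (n<1+n ν₀) (toNA bbig) (BtoA H (toNA bsm) (toNA bbig) eB)
  where
  ν₀ : ℕ
  ν₀ = suc ν₁
  ν : ℕ
  ν = suc ν₀
  open Overlap ret rep ν w 0 0 c L
  eB : at B ν₀ ≡ at B (ν + (c + ν₀))
  eB = block₁≡block₂ rep w ν 0 c 0 LB ν₀ (n<1+n ν₀)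
  bsm : ν₀ < NB
  bsm = slot-bound (blk₁ {0} {c} {0} {ν} ν₀ (n<1+n ν₀) refl)
  bbig : ν + (c + ν₀) < NB
  bbig = slot-bound (blk₂ {0} {c} {0} {ν} ν₀ (n<1+n ν₀) refl)
... | inj₁ e = <⇒≢ (m≤m+n (suc (suc ν₁)) _) (sym e)
... | inj₂ e = <⇒≢ (<-witness (suc (suc ν₁) + (0 + partner ret (suc (suc ν₁)) (suc ν₁))) _ (suc ν₁ + ν₁) (ee ν₁)) (sym e)
  where
  ee : ∀ ν₁ → suc (suc ν₁) + (0 + partner ret (suc (suc ν₁)) (suc ν₁)) + suc (suc ν₁ + ν₁) ≡ suc (suc ν₁) + (suc ν₁ + suc ν₁)
  ee ν₁ rewrite n∸n≡0 ν₁ = e2 ν₁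
    where
    e2 : ∀ ν₁ → suc (suc ν₁) + 0 + suc (suc ν₁ + ν₁) ≡ suc (suc ν₁) + (suc ν₁ + suc ν₁)
    e2 = solve-∀

ret-rep-width-one : ∀ ν₀ w c (L : length w ≡ 0 + 0 + c) →
  SamePattern (insertAt ret w (suc ν₀) 0 0) (insertAt rep w (suc ν₀) (0 + 0) c) → c ≡ ν₀ → c ≡ 0
ret-rep-width-one zero w c L H e = e
ret-rep-width-one (suc ν₁) w c L H e = ⊥-elim (ret-rep-wide-impossible ν₁ w c L H e)

TerminalCase : Kind → Kind → ℕ → Word → ℕ → ℕ → Set
TerminalCase K₁ K₂ ν w a c = (L : length w ≡ a + 0 + c) →
  SamePattern (insertAt K₁ w ν 0 a) (insertAt K₂ w ν (a + 0) c) → a < ν → (c ≡ a) × MatchesT K₁ K₂ ν a 0 w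

terminal-rep-rep : ∀ ν w a c → TerminalCase rep rep ν w a c
terminal-rep-rep ν w a c L H a<ν = c≡a , TerminalRepeat.repeat-terminal ν w a c L H a<ν c≡a
  where
  c≡a : c ≡ a
  c≡a = trans (sym (+-identityʳ c)) (sym (Terminal.block₁-edge rep rep ν w a c L H a<ν))

terminal-ret-ret : ∀ ν₀ w a c → TerminalCase ret ret (suc ν₀) w a c
terminal-ret-ret ν₀ w a c L H a<ν = both-empty c≡0 a≡0
  where
  edge : ν₀ ∸ a ≡ c + ν₀
  edge = Terminal.block₁-edge ret ret (suc ν₀) w a c L H a<ν
  c≡0 : c ≡ 0
  c≡0 = m+n≤n⇒m≡0 c ν₀ (subst (_≤ ν₀) edge (m∸n≤m ν₀ a))
  a≡0 : a ≡ 0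
  a≡0 = +-cancelˡ-≡ ν₀ a 0 (trans (sym (cong (_+ a) (trans edge (cong (_+ ν₀) c≡0)))) (trans (m∸n+n≡m (≤-pred a<ν)) (sym (+-identityʳ ν₀))))
  both-empty : c ≡ 0 → a ≡ 0 → (c ≡ a) × MatchesT ret ret (suc ν₀) a 0 w
  both-empty refl refl = refl , (0 , refl , length0⇒SamePattern[] w L)

terminal-rep-ret : ∀ ν₀ w a c → TerminalCase rep ret (suc ν₀) w a c
terminal-rep-ret ν₀ w zero c L H a<ν = m+n≤n⇒m≡0 c ν₀ (subst (_≤ ν₀) (Terminal.block₁-edge rep ret (suc ν₀) w 0 c L H a<ν) z≤n) , tt
terminal-rep-ret ν₀ w (suc a) c L H a<ν = ⊥-elim (Clashes.first-not-blk₂ rep ret (suc ν₀) w (suc a) 0 c L H 0 (s≤s z≤n) (s≤s z≤n) eq)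
  where
  c≡0 : c ≡ 0
  c≡0 = m+n≤n⇒m≡0 c ν₀ (subst (_≤ ν₀) (Terminal.block₁-edge rep ret (suc ν₀) w (suc a) c L H a<ν) (≤-pred a<ν))
  eq : suc ν₀ + (suc a + 0) ≡ suc a + 0 + (suc ν₀ + (c + 0))
  eq rewrite c≡0 = e ν₀ a
    where
    e : ∀ ν₀ a → suc ν₀ + (suc a + 0) ≡ suc a + 0 + (suc ν₀ + (0 + 0))
    e = solve-∀

terminal-ret-rep : ∀ ν₀ w a c → TerminalCase ret rep (suc ν₀) w a c
terminal-ret-rep ν₀ w zero c L H a<ν = ret-rep-width-one ν₀ w c L H (trans (sym (+-identityʳ c)) (sym edge)) , tt
  where
  edge : ν₀ ∸ 0 ≡ c + 0
  edge = Terminal.block₁-edge ret rep (suc ν₀) w 0 c L H a<ν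
terminal-ret-rep ν₀ w (suc a) c L H a<ν = ⊥-elim (Clashes.first-not-blk₂ ret rep (suc ν₀) w (suc a) 0 c L H (suc a) (s≤s z≤n) a<ν eq)
  where
  c+a≡ν₀ : c + suc a ≡ ν₀
  c+a≡ν₀ = trans (cong (_+ suc a) (trans (sym (+-identityʳ c)) (sym (Terminal.block₁-edge ret rep (suc ν₀) w (suc a) c L H a<ν)))) (m∸n+n≡m (≤-pred a<ν))
  eq : suc ν₀ + (suc a + (suc ν₀ ∸ 1)) ≡ suc a + 0 + (suc ν₀ + (c + suc a))
  eq rewrite c+a≡ν₀ = e ν₀ a
    where
    e : ∀ ν₀ a → suc ν₀ + (suc a + ν₀) ≡ suc a + 0 + (suc ν₀ + ν₀)
    e = solve-∀

terminal : ∀ K₁ K₂ ν' w a c → TerminalCase K₁ K₂ (suc ν') w a c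
terminal rep rep ν' = terminal-rep-rep (suc ν')
terminal ret ret ν' = terminal-ret-ret ν'
terminal rep ret ν' = terminal-rep-ret ν'
terminal ret rep ν' = terminal-ret-rep ν'

Shape : Kind → Kind → ℕ → Word → ℕ → ℕ → ℕ → Set
Shape K₁ K₂ ν w a d c = Σ ℕ λ p → (d ≡ p * (ν + ν)) × (c ≡ a) × MatchesT K₁ K₂ ν a p w

gap-shape : ∀ {K₁ K₂ ν w a d' c} (R : Reduction K₁ K₂ ν w a d' c) →
  Shape K₁ K₂ ν (Reduction.w₀ R) a d' c → Shape K₁ K₂ ν w a (ν + ν + d') c
gap-shape {K₁} {K₂} {ν} {w} {a} R (p , refl , refl , M) =
  suc p , refl , refl , MatchesT-step K₁ K₂ ν a p w w₀ (a + p * (ν + ν)) M reinserted length-w₀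
  where open Reduction R

end-shape : ∀ {K₁ K₂ ν' w a' c'} (R : Reduction K₁ K₂ (suc ν') w a' 0 c') →
  Shape K₁ K₂ (suc ν') (Reduction.w₀ R) a' 0 c' → Shape K₁ K₂ (suc ν') w (suc ν' + a') 0 (suc ν' + c')
end-shape {K₁} {K₂} {ν'} {w} {a'} R (zero , _ , refl , M) =
  0 , refl , refl , MatchesT-base K₁ K₂ ν' a' w w₀ M reinserted′ (trans length-w₀ (cong (_+ a') (+-identityʳ a')))
  where
  open Reduction R
  reinserted′ : SamePattern w (insertAt K₂ w₀ (suc ν') a' a')
  reinserted′ = subst (λ t → SamePattern w (insertAt K₂ w₀ (suc ν') t a')) (+-identityʳ a') reinserted
end-shape R (suc p , () , _)

small-gap-impossible : ∀ K₁ K₂ ν' w a d₀ c (L : length w ≡ a + suc d₀ + c) →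
  SamePattern (insertAt K₁ w (suc ν') 0 a) (insertAt K₂ w (suc ν') (a + suc d₀) c) → suc d₀ < suc ν' + suc ν' → ⊥
small-gap-impossible K₁ K₂ ν' w a d₀ c L H d<2ν with <⊎+ (suc ν') (suc d₀)
... | inj₁ d<ν = blk₁-not-blk₁ 0 (ν ∸ suc d₀) (s≤s z≤n) (∸-monoʳ-< {o = 0} (s≤s z≤n) (<⇒≤ d<ν)) eq
  where
  ν : ℕ
  ν = suc ν'
  open Clashes K₁ K₂ ν w a (suc d₀) c L H using (blk₁-not-blk₁)
  eq : ν + (a + 0) ≡ a + suc d₀ + (ν ∸ suc d₀)
  eq = trans (e a ν) (trans (cong (a +_) (sym (m+[n∸m]≡n (<⇒≤ d<ν)))) (sym (+-assoc a (suc d₀) _)))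
    where
    e : ∀ a ν → ν + (a + 0) ≡ a + ν
    e = solve-∀
... | inj₂ (d₁ , d≡) = blk₁-not-blk₁ d₁ 0 (+-cancelˡ-< ν d₁ ν (subst (_< ν + ν) d≡ d<2ν)) (s≤s z≤n) eq
  where
  ν : ℕ
  ν = suc ν'
  open Clashes K₁ K₂ ν w a (suc d₀) c L H using (blk₁-not-blk₁)
  eq : ν + (a + d₁) ≡ a + suc d₀ + 0
  eq = trans (e a ν d₁) (cong (λ z → a + z + 0) (sym d≡))
    where
    e : ∀ a ν d₁ → ν + (a + d₁) ≡ a + (ν + d₁) + 0
    e = solve-∀

short-end-impossible : ∀ K₁ K₂ ν' w a' c (L : length w ≡ suc ν' + a' + 0 + c) →
  SamePattern (insertAt K₁ w (suc ν') 0 (suc ν' + a')) (insertAt K₂ w (suc ν') (suc ν' + a' + 0) c) → c < suc ν' → ⊥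
short-end-impossible K₁ K₂ ν' w a' c L H c<ν =
  Clashes.blk₁-not-blk₂ K₁ K₂ ν w (ν + a') 0 c L H c 0 c<ν (s≤s z≤n) (m≤m+n ν a') (e ν a' c)
  where
  ν : ℕ
  ν = suc ν'
  e : ∀ ν a' c → ν + (ν + a' + c) ≡ ν + a' + 0 + (ν + (c + 0))
  e = solve-∀

OverlapsShaped : Kind → Kind → ℕ → ℕ → Set
OverlapsShaped K₁ K₂ ν n = ∀ w a d c → length w ≡ n → (L : length w ≡ a + d + c) →
  SamePattern (insertAt K₁ w ν 0 a) (insertAt K₂ w ν (a + d) c) → Shape K₁ K₂ ν w a d c

overlapsShaped : ∀ K₁ K₂ ν' n → OverlapsShaped K₁ K₂ (suc ν') n
overlapsShaped K₁ K₂ ν' = <-rec (OverlapsShaped K₁ K₂ ν) step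
  where
  ν : ℕ
  ν = suc ν'
  shorter : ∀ {w a d c} (R : Reduction K₁ K₂ ν w a d c) → OverlapsShaped K₁ K₂ ν (length (Reduction.w₀ R)) →
    Shape K₁ K₂ ν (Reduction.w₀ R) a d c
  shorter R shaped = shaped (w₀ R) _ _ _ refl (length-w₀ R) (overlap₀ R)
    where open Reduction
  step : ∀ n → (∀ {m} → m < n → OverlapsShaped K₁ K₂ ν m) → OverlapsShaped K₁ K₂ ν n
  step n rec w a d c n≡ L H with <⊎+ (ν + ν) d
  ... | inj₂ (d' , refl) = gap-shape R (shorter R (rec (subst (_ <_) n≡ (Reduction-shorter R))))
    where R = GapReduction.reduction K₁ K₂ ν w a d' c L H
  step n rec w a (suc d₀) c n≡ L H | inj₁ d<2ν = ⊥-elim (small-gap-impossible K₁ K₂ ν' w a d₀ c L H d<2ν)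
  step n rec w a zero c n≡ L H | inj₁ _ with <⊎+ ν a | <⊎+ ν c
  ... | inj₁ a<ν | _ = 0 , refl , terminal K₁ K₂ ν' w a c L H a<ν
  ... | inj₂ (a' , refl) | inj₁ c<ν = ⊥-elim (short-end-impossible K₁ K₂ ν' w a' c L H c<ν)
  ... | inj₂ (a' , refl) | inj₂ (c' , refl) = end-shape R (shorter R (rec (subst (_ <_) n≡ (Reduction-shorter R))))
    where R = EndReduction.reduction K₁ K₂ ν w a' c' L H

insertions-overlap : ∀ I₁ I₂ ν w a b → a ≤ b → b ≤ length w →
  insert I₁ w ν 1 (suc a) ∼ insert I₂ w ν (suc b) (length w + 1) →
  SamePattern (insertAt I₁ w ν 0 a) (insertAt I₂ w ν (a + (b ∸ a)) (length w ∸ b))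
insertions-overlap I₁ I₂ ν w a b a≤b b≤n ins∼ins =
  subst₂ SamePattern (insert≡insertAt I₁ w ν 0 a) (trans (cong₂ (insert I₂ w ν) k₂≡ ℓ₂≡) (insert≡insertAt I₂ w ν (a + (b ∸ a)) (length w ∸ b)))
    (∼⇒SamePattern ins∼ins)
  where
  k₂≡ : suc b ≡ suc (a + (b ∸ a))
  k₂≡ = cong suc (sym (m+[n∸m]≡n a≤b))
  ℓ₂≡ : length w + 1 ≡ suc (a + (b ∸ a) + (length w ∸ b))
  ℓ₂≡ = trans (+-comm (length w) 1) (cong suc (trans (sym (m+[n∸m]≡n b≤n)) (cong (_+ (length w ∸ b)) (sym (m+[n∸m]≡n a≤b)))))

overlap-shape : ∀ I₁ I₂ ν' w a b → a ≤ b → b ≤ length w →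
  insert I₁ w (suc ν') 1 (suc a) ∼ insert I₂ w (suc ν') (suc b) (length w + 1) →
  Shape I₁ I₂ (suc ν') w a (b ∸ a) (length w ∸ b)
overlap-shape I₁ I₂ ν' w a b a≤b b≤n ins∼ins =
  overlapsShaped I₁ I₂ ν' _ w a (b ∸ a) (length w ∸ b) refl lengths (insertions-overlap I₁ I₂ (suc ν') w a b a≤b b≤n ins∼ins)
  where
  lengths : length w ≡ a + (b ∸ a) + (length w ∸ b)
  lengths = trans (sym (m+[n∸m]≡n b≤n)) (cong (_+ (length w ∸ b)) (sym (m+[n∸m]≡n a≤b)))

suc≤+1⇒≤ : ∀ {m n} → suc m ≤ n + 1 → m ≤ n
suc≤+1⇒≤ {m} {n} le = +-cancelʳ-≤ 1 m n (subst (_≤ n + 1) (+-comm 1 m) le)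

positive-multiple : ∀ {d} p m → 0 < d → d ≡ p * m → 1 ≤ p
positive-multiple zero m 0<d refl = 0<d
positive-multiple (suc p) m _ _ = s≤s z≤n

take-middle-drop : ∀ (w : Word) a b → a ≤ b → take a w ++ take (b ∸ a) (drop a w) ++ drop b w ≡ w
take-middle-drop w a b a≤b = begin
  take a w ++ take (b ∸ a) (drop a w) ++ drop b w
    ≡⟨ cong (λ z → take a w ++ take (b ∸ a) (drop a w) ++ drop z w) (m+[n∸m]≡n a≤b) ⟨
  take a w ++ take (b ∸ a) (drop a w) ++ drop (a + (b ∸ a)) w
    ≡⟨ cong (λ z → take a w ++ take (b ∸ a) (drop a w) ++ z) (drop-drop a (b ∸ a) w) ⟨
  take a w ++ take (b ∸ a) (drop a w) ++ drop (b ∸ a) (drop a w)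
    ≡⟨ cong (take a w ++_) (take++drop≡id (b ∸ a) (drop a w)) ⟩
  take a w ++ drop a w
    ≡⟨ take++drop≡id a w ⟩
  w ∎
  where open ≡-Reasoning

conclusion : ∀ I₁ I₂ ν' a p (w z : Word) → z ≡ w → MatchesT I₁ I₂ (suc ν') a p w →
  (I₁ ≡ rep → I₂ ≡ rep → z ∼ Tρ (suc ν') a p) ×
  (I₁ ≡ ret → I₂ ≡ ret → (suc ν') ∣ a × z ∼ Tτ (suc ν') a p)
conclusion rep rep ν' a p w z refl M = (λ _ _ → SamePattern⇒∼ w _ M) , (λ ())
conclusion ret ret ν' a p w z refl (h , refl , M) =
  (λ ()) , (λ _ _ → divides h refl , SamePattern⇒∼ w _ (subst (λ t → SamePattern w (iterT ret (suc ν') (h * suc ν') p (Int t (suc ν')))) (sym (m*n/n≡m h (suc ν'))) M))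
conclusion rep ret ν' a p w z _ _ = (λ _ ()) , (λ ())
conclusion ret rep ν' a p w z _ _ = (λ ()) , (λ _ ())

proposition3p10 : (w : Word) (n ν : ℕ) → DOW w → Ascending w → length w ≡ n → 1 ≤ ν →
    (I₁ I₂ : Kind) (k₁ ℓ₁ k₂ ℓ₂ : ℕ) →
    1 ≤ k₁ → k₁ ≤ ℓ₁ → ℓ₁ ≤ n + 1 →
    1 ≤ k₂ → k₂ ≤ ℓ₂ → ℓ₂ ≤ n + 1 →
    insert I₁ w ν k₁ ℓ₁ ∼ insert I₂ w ν k₂ ℓ₂ →
    k₁ ≡ 1 → ℓ₂ ≡ n + 1 → ℓ₁ < k₂ →
    ∃ λ p → 1 ≤ p × k₂ ∸ ℓ₁ ≡ 2 * p * ν ×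
    ∃ λ q → length (take (ℓ₁ ∸ 1) w) ≡ q × length (drop (k₂ ∸ 1) w) ≡ q ×
    (I₁ ≡ rep → I₂ ≡ rep →
    (take (ℓ₁ ∸ 1) w ++ take (k₂ ∸ ℓ₁) (drop (ℓ₁ ∸ 1) w) ++ drop (k₂ ∸ 1) w) ∼ Tρ ν q p) ×
    (I₁ ≡ ret → I₂ ≡ ret →
    ν ∣ q × (take (ℓ₁ ∸ 1) w ++ take (k₂ ∸ ℓ₁) (drop (ℓ₁ ∸ 1) w) ++ drop (k₂ ∸ 1) w) ∼ Tτ ν q p)
proposition3p10 w .(length w) (suc ν') _ _ refl (s≤s z≤n) I₁ I₂ .1 (suc a) (suc b) .(length w + 1) _ _ _ _ ℓ₂≤n+1 _ ins∼ins refl refl (s≤s a<b)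
  with overlap-shape I₁ I₂ ν' w a b (<⇒≤ a<b) (suc≤+1⇒≤ ℓ₂≤n+1) ins∼ins
... | p , d≡ , c≡a , M =
  p , positive-multiple p _ (m<n⇒0<n∸m a<b) d≡ , trans d≡ (double p (suc ν')) ,
  a , length-take-≤ a w (≤-trans (<⇒≤ a<b) (suc≤+1⇒≤ ℓ₂≤n+1)) , trans (length-drop b w) c≡a ,
  conclusion I₁ I₂ ν' a p w _ (take-middle-drop w a b (<⇒≤ a<b)) M
  where
  double : ∀ p ν → p * (ν + ν) ≡ 2 * p * ν
  double = solve-∀
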